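{- Let $q$ be an odd prime power and let $A\in M_2(\mathbb{F}_{q^2})$. Assume that the base polynomial $F_A$ is nonsingular (i.e. the projective plane curve $F_A=0$ has no singular points). Then the boundary generating curve is contained in the numerical range: $\Gamma_{F_A}^\wedge\subseteq W(A)$.
   Context: Fix a nonsquare $\alpha\in\mathbb{F}_q$ and $\beta\in\mathbb{F}_{q^2}$ with $\beta^2=\alpha$, so $\mathbb{F}_{q^2}=\mathbb{F}_q[\beta]$ and every element is uniquely $x+\beta y$ with $x,y\in\mathbb{F}_q$. Write $\overline{x}:=x^q$ and $|x|^2:=x\overline{x}$. For a matrix $M$, $M^*$ is the transpose with $\overline{\cdot}$ applied entrywise; $M$ is Hermitian if $M^*=M$. The Hermitian form on $\mathbb{F}_{q^2}^n$ is $\langle \mathbf u,\mathbf v\rangle:=\mathbf v^*\mathbf u$. The numerical range of $A\in M_n(\mathbb{F}_{q^2})$ is $W(A)=\{\langle A\mathbf v,\mathbf v\rangle : \mathbf v\in\mathbb{F}_{q^2}^n,\ \langle \mathbf v,\mathbf v\rangle=1\}$. Let $H_1=(A+A^*)/2$ and $H_2=(A-A^*)/(2\beta)$ (both Hermitian, $A=H_1+\beta H_2$). The base polynomial is $F_A(x,y,t)=\det(xH_1+yH_2+tI_n)$, a homogeneous polynomial of degree $n$ with coefficients in $\mathbb{F}_q$; its zero set $\Gamma_{F_A}$ in $\mathbb{P}^2(\mathbb{F}_{q^2})$ is the base curve. The boundary generating curve $\Gamma_{F_A}^\wedge$ is the dual curve of $\Gamma_{F_A}$: the set of points $(F_x(P):F_y(P):F_t(P))$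 for nonsingular points $P$ of $\Gamma_{F_A}$ (the points dual to tangent lines of $\Gamma_{F_A}$; a point $(a:b:c)$ corresponds to the line $ax+by+ct=0$). Its points of the form $(a:b:1)$ with $a,b\in\mathbb{F}_q$ are identified with $a+\beta b\in\mathbb{F}_{q^2}$, and as a subset of $\mathbb{F}_{q^2}$, $\Gamma_{F_A}^\wedge$ means the set of these. -}

module Defs where

open import Level using (0ℓ)
open import Data.Nat using (ℕ; zero; suc)
open import Data.Fin using (Fin; zero; suc)
open import Data.Product using (_×_; _,_; Σ; ∃; proj₁; proj₂)
open import Relation.Binary.PropositionalEquality using (_≡_; _≢_)
open import Relation.Nullary using (¬_)
open import Function.Bundles using (_↔_)
open import Algebra.Structures using (IsCommutativeRing)

record FiniteField (q : ℕ) : Set₁ where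
  infixl 7 _*_
  infixl 6 _+_
  field
    Carrier  : Set
    _+_ _*_  : Carrier → Carrier → Carrier
    -_       : Carrier → Carrier
    0# 1#    : Carrier
    _⁻¹      : Carrier → Carrier
    isCommutativeRing : IsCommutativeRing _≡_ _+_ _*_ -_ 0# 1#
    0≢1      : 0# ≢ 1#
    ⁻¹-inverse : ∀ x → x ≢ 0# → x * (x ⁻¹) ≡ 1#
    card     : Carrier ↔ Fin q

-- Everything below is relative to a finite field K = F_q and a fixed
-- element α of K (assumed nonsquare in the statement).
-- F_{q^2} = F_q[β], β² = α, is modelled as pairs (x , y) ↦ x + β y.

module Over {q : ℕ} (K : FiniteField q) (α : FiniteField.Carrier K) where
  open FiniteField K

  IsNonsquare : Carrier → Set
  IsNonsquare a = ∀ x → x * x ≢ a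

  L : Set
  L = Carrier × Carrier

  ι : Carrier → L
  ι a = (a , 0#)

  β : L
  β = (0# , 1#)

  0L 1L : L
  0L = ι 0#
  1L = ι 1#

  _+L_ : L → L → L
  (x₁ , y₁) +L (x₂ , y₂) = (x₁ + x₂ , y₁ + y₂)

  -L_ : L → L
  -L (x , y) = (- x , - y)

  _-L_ : L → L → L
  u -L v = u +L (-L v)

  -- (x₁ + β y₁)(x₂ + β y₂) = (x₁x₂ + α y₁y₂) + β (x₁y₂ + y₁x₂)
  _*L_ : L → L → L
  (x₁ , y₁) *L (x₂ , y₂) = (x₁ * x₂ + α * (y₁ * y₂) , x₁ * y₂ + y₁ * x₂)

  _^L_ : L → ℕ → L
  z ^L zero    = 1L
  z ^L (suc n) = z *L (z ^L n)

  -- field inverse in F_{q^2}: (x + β y)⁻¹ = (x − β y)/(x² − α y²)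
  invL : L → L
  invL (x , y) = let n = x * x + - (α * (y * y)) in (x * (n ⁻¹) , (- y) * (n ⁻¹))

  conj : L → L
  conj z = z ^L q

  two : L
  two = 1L +L 1L

  Mat : Set
  Mat = Fin 2 → Fin 2 → L

  Vec2 : Set
  Vec2 = Fin 2 → L

  _⋆ : Mat → Mat
  (M ⋆) i j = conj (M j i)

  scale : L → Mat → Mat
  scale c M i j = c *L M i j

  _+M_ _-M_ : Mat → Mat → Mat
  (M +M N) i j = M i j +L N i j
  (M -M N) i j = M i j -L N i j

  mulVec : Mat → Vec2 → Vec2
  mulVec M v i = (M i zero *L v zero) +L (M i (suc zero) *L v (suc zero))

  ⟨_,_⟩ : Vec2 → Vec2 → L
  ⟨ u , v ⟩ = (conj (v zero) *L u zero) +L (conj (v (suc zero)) *L u (suc zero))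

  InW : Mat → L → Set
  InW A z = Σ Vec2 λ v → (⟨ v , v ⟩ ≡ 1L) × (⟨ mulVec A v , v ⟩ ≡ z)

  H₁ H₂ : Mat → Mat
  H₁ A = scale (invL two) (A +M (A ⋆))
  H₂ A = scale (invL (two *L β)) (A -M (A ⋆))

  data Poly : Set where
    var : Fin 3 → Poly
    con : L → Poly
    _⊕_ : Poly → Poly → Poly
    _⊗_ : Poly → Poly → Poly
    ⊖_  : Poly → Poly

  eval : (Fin 3 → L) → Poly → L
  eval P (var i) = P i
  eval P (con c) = c
  eval P (f ⊕ g) = eval P f +L eval P g
  eval P (f ⊗ g) = eval P f *L eval P g
  eval P (⊖ f)   = -L eval P f

  δ : {n : ℕ} → Fin n → Fin n → L
  δ zero zero = 1L
  δ (suc i) (suc j) = δ i j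
  δ _ _ = 0L

  ∂ : Fin 3 → Poly → Poly
  ∂ i (var j) = con (δ i j)
  ∂ i (con c) = con 0L
  ∂ i (f ⊕ g) = ∂ i f ⊕ ∂ i g
  ∂ i (f ⊗ g) = (∂ i f ⊗ g) ⊕ (f ⊗ ∂ i g)
  ∂ i (⊖ f)   = ⊖ (∂ i f)

  vx vy vt : Poly
  vx = var zero
  vy = var (suc zero)
  vt = var (suc (suc zero))

  pencil : Mat → Fin 2 → Fin 2 → Poly
  pencil A i j = ((vx ⊗ con (H₁ A i j)) ⊕ (vy ⊗ con (H₂ A i j))) ⊕ diag i j
    where
    diag : Fin 2 → Fin 2 → Poly
    diag zero zero = vt
    diag (suc zero) (suc zero) = vt
    diag _ _ = con 0L

  baseF : Mat → Poly
  baseF A = (pencil A zero zero ⊗ pencil A (suc zero) (suc zero))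
            ⊕ (⊖ (pencil A zero (suc zero) ⊗ pencil A (suc zero) zero))

  -- a point of P²(F_{q²}) given by homogeneous coordinates
  NonzeroPt : (Fin 3 → L) → Set
  NonzeroPt P = ¬ (∀ i → P i ≡ 0L)

  SingularAt : Poly → (Fin 3 → L) → Set
  SingularAt F P = (eval P F ≡ 0L) × (∀ i → eval P (∂ i F) ≡ 0L)

  NonsingularCurve : Poly → Set
  NonsingularCurve F = ∀ P → NonzeroPt P → ¬ SingularAt F P

  -- (a , b) ∈ F_q² , identified with a + β b, lies on the dual curve:
  -- (a : b : 1) = (F_x(P) : F_y(P) : F_t(P)) for a nonsingular point P
  -- of F = 0.
  InDual : Poly → Carrier → Carrier → Set
  InDual F a b =
    Σ (Fin 3 → L) λ P → NonzeroPt P × (eval P F ≡ 0L) × ¬ SingularAt F P ×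
      Σ L λ λ' → (λ' ≢ 0L) ×
        (eval P (∂ zero F) ≡ λ' *L ι a) ×
        (eval P (∂ (suc zero) F) ≡ λ' *L ι b) ×
        (eval P (∂ (suc (suc zero)) F) ≡ λ' *L 1L)

{-# OPTIONS --safe #-}
-- Write A = H₁ + βH₂ with H₁, H₂ Hermitian and M(X) = x H₁ + y H₂ + t I, so that F_A = det M and
-- ∂F_A/∂X_c = tr (C_c adj M) for (C_x, C_y, C_t) = (H₁, H₂, I). A point (a : b : 1) of the dual
-- curve comes from a smooth point P, which we rescale so that ∇F_A(P) = (a, b, 1). As the C_c are
-- Hermitian, ∇F_A(P̄) is the conjugate of ∇F_A(P), which is real; hence P − P̄ has zero gradient
-- and, by Euler's identity, lies on the curve, so nonsingularity forces P = P̄. Then M(P) is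
-- Hermitian with determinant 0, and so is N = adj M(P). Since the norm F_{q²} → F_q is onto,
-- N = v v* for some v, and then ⟨v, v⟩ = tr N = ∂F_A/∂t (P) = 1 and
-- ⟨Av, v⟩ = tr (A N) = tr (H₁ N) + β tr (H₂ N) = a + βb.
-- On F_q[β], z̄ = z^q is additive because the characteristic is p, fixes F_q by Fermat, and is not
-- the identity because x^q − x has at most q roots, so β̄ = −β; the norm is onto because each of
-- its fibres is the root set of some x^(q+1) − d, hence has at most q + 1 points.
module Submission where

open import Defs
open import Level using (0ℓ)
open import Algebra.Bundles using (CommutativeRing; CommutativeSemiring; CommutativeMonoid)
open import Algebra.Structures using (IsCommutativeMonoid; IsCommutativeRing)
import Algebra.Properties.AbelianGroup as AbelianGroupProperties
import Algebra.Properties.CommutativeMonoid.Sum as CommutativeMonoidSum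
import Algebra.Properties.CommutativeSemiring.Binomial as Binomial
import Algebra.Properties.CommutativeSemiring.Exp as CommutativeSemiringExp
import Algebra.Properties.Monoid.Sum as MonoidSum
import Algebra.Properties.Ring as RingProperties
import Algebra.Properties.Semiring.Exp as SemiringExp
import Algebra.Properties.Semiring.Mult as SemiringMult
import Algebra.Properties.Semiring.Mult.TCOptimised as SemiringMultTCOptimised
import Algebra.Solver.Ring
open import Algebra.Solver.Ring.AlmostCommutativeRing using (fromCommutativeRing; _-Raw-AlmostCommutative⟶_)
open import Data.Empty using (⊥-elim)
open import Data.Fin as Fin using (Fin; fromℕ; inject₁; punchIn)
open import Data.Fin.Patterns using (0F; 1F; 2F)
import Data.Fin.Properties as Fin
open import Data.Fin.Permutation using (permutation)
open import Data.Integer as ℤ using (ℤ; -[1+_]; _⊖_; 0ℤ; 1ℤ)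
import Data.Integer.Properties as ℤ
open import Data.List as List using (List; []; _∷_; length; map; filter; tabulate; cartesianProduct)
import Data.List.Properties as List
open import Data.List.Membership.Propositional using (_∈_; lose)
open import Data.List.Membership.Propositional.Properties using (∈-tabulate⁺; ∈-filter⁺; ∈-filter⁻)
open import Data.List.Relation.Unary.All as All using (All; []; _∷_)
open import Data.List.Relation.Unary.AllPairs using (_∷_)
open import Data.List.Relation.Unary.Any as Any using (Any; here; there; any?; satisfied)
open import Data.List.Relation.Unary.Unique.Propositional using (Unique)
import Data.List.Relation.Unary.Unique.Propositional.Properties as Unique
import Data.List.Relation.Unary.Unique.Setoid as SetoidUnique
import Data.Maybe as Maybe
open import Data.Nat as ℕ using (ℕ; zero; suc; _<_; _≤_; s≤s; z≤n; nonTrivial⇒n>1)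
open import Data.Nat.Combinatorics using (_C_; nCn≡1; nC1≡n; nCk+nC[k+1]≡[n+1]C[k+1])
open import Data.Nat.Divisibility using (_∣_; divides; ∣⇒≤)
import Data.Nat.ListAction as ℕ
open import Data.Nat.Primality using (Prime; euclidsLemma; prime⇒nonTrivial; prime⇒nonZero)
import Data.Nat.Properties as ℕ
open import Data.Nat.Solver using (module +-*-Solver)
open import Data.Product using (Σ; _,_; proj₁; proj₂; uncurry)
open import Data.Sum using (_⊎_; inj₁; inj₂; [_,_]′)
open import Function using (_∘_; Inverse)
open import Relation.Binary.Consequences using (dec⇒weaklyDec)
open import Relation.Binary.Definitions using (DecidableEquality)
open import Relation.Binary.PropositionalEquality as ≡ using (_≡_; _≢_)
import Relation.Binary.Reasoning.Setoid as SetoidReasoning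
open import Relation.Nullary using (¬_; yes; no; ¬?; contradiction)
open import Relation.Nullary.Decidable using (decidable-stable)

module IntegerCoefficientSolver {c ℓ} (R : CommutativeRing c ℓ) where

  open import Data.Integer using (+_)
  open CommutativeRing R
  open AbelianGroupProperties +-abelianGroup using (ε⁻¹≈ε; ⁻¹-involutive; ⁻¹-∙-comm)
  open RingProperties ring using (-‿distribˡ-*; -‿distribʳ-*)
  open SemiringMultTCOptimised semiring using (_×_; ×-homo-+; ×1-homo-*)
  open SetoidReasoning setoid

  fromℤ : ℤ → Carrier
  fromℤ (+ n)      = n × 1#
  fromℤ -[1+ n ] = - (suc n × 1#)

  fromℤ-⊖ : ∀ m n → fromℤ (m ⊖ n) ≈ m × 1# - n × 1#
  fromℤ-⊖ m       zero    = sym (trans (+-congˡ ε⁻¹≈ε) (+-identityʳ _))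
  fromℤ-⊖ zero    (suc n) = sym (+-identityˡ _)
  fromℤ-⊖ (suc m) (suc n) = begin
    fromℤ (suc m ⊖ suc n)            ≡⟨ ≡.cong fromℤ (ℤ.[1+m]⊖[1+n]≡m⊖n m n) ⟩
    fromℤ (m ⊖ n)                    ≈⟨ fromℤ-⊖ m n ⟩
    M - N                        ≈⟨ +-congʳ (+-identityˡ M) ⟨
    (0# + M) - N                 ≈⟨ +-congʳ (+-congʳ (-‿inverseʳ 1#)) ⟨
    ((1# - 1#) + M) - N          ≈⟨ +-congʳ (+-assoc 1# (- 1#) M) ⟩
    (1# + (- 1# + M)) - N        ≈⟨ +-congʳ (+-congˡ (+-comm (- 1#) M)) ⟩
    (1# + (M - 1#)) - N          ≈⟨ +-congʳ (+-assoc 1# M (- 1#)) ⟨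
    ((1# + M) - 1#) - N          ≈⟨ +-assoc (1# + M) (- 1#) (- N) ⟩
    (1# + M) + (- 1# + - N)      ≈⟨ +-congˡ (⁻¹-∙-comm 1# N) ⟩
    (1# + M) - (1# + N)          ≈⟨ +-cong (×-homo-+ 1# 1 m) (-‿cong (×-homo-+ 1# 1 n)) ⟨
    suc m × 1# - suc n × 1#      ∎
    where
    M = m × 1#
    N = n × 1#

  fromℤ-+ : ∀ i j → fromℤ (i ℤ.+ j) ≈ fromℤ i + fromℤ j
  fromℤ-+ (+ m)    (+ n)    = ×-homo-+ 1# m n
  fromℤ-+ (+ m)    -[1+ n ] = fromℤ-⊖ m (suc n)
  fromℤ-+ -[1+ m ] (+ n)    = trans (fromℤ-⊖ n (suc m)) (+-comm _ _)
  fromℤ-+ -[1+ m ] -[1+ n ] = begin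
    - (suc (suc (m ℕ.+ n)) × 1#)       ≡⟨ ≡.cong (λ k → - (suc k × 1#)) (ℕ.+-suc m n) ⟨
    - ((suc m ℕ.+ suc n) × 1#)         ≈⟨ -‿cong (×-homo-+ 1# (suc m) (suc n)) ⟩
    - (suc m × 1# + suc n × 1#)        ≈⟨ ⁻¹-∙-comm _ _ ⟨
    fromℤ -[1+ m ] + fromℤ -[1+ n ]        ∎

  fromℤ-neg : ∀ i → fromℤ (ℤ.- i) ≈ - fromℤ i
  fromℤ-neg (+ zero)  = sym ε⁻¹≈ε
  fromℤ-neg (+ suc n) = refl
  fromℤ-neg -[1+ n ]  = sym (⁻¹-involutive _)

  fromℤ-*-pos : ∀ m j → fromℤ (+ m ℤ.* j) ≈ fromℤ (+ m) * fromℤ j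
  fromℤ-*-pos m (+ n)    = trans (reflexive (≡.cong fromℤ (≡.sym (ℤ.pos-* m n)))) (×1-homo-* m n)
  fromℤ-*-pos m -[1+ n ] = begin
    fromℤ (+ m ℤ.* ℤ.- + suc n)         ≡⟨ ≡.cong fromℤ (ℤ.neg-distribʳ-* (+ m) (+ suc n)) ⟨
    fromℤ (ℤ.- (+ m ℤ.* + suc n))       ≈⟨ fromℤ-neg (+ m ℤ.* + suc n) ⟩
    - fromℤ (+ m ℤ.* + suc n)           ≈⟨ -‿cong (fromℤ-*-pos m (+ suc n)) ⟩
    - (fromℤ (+ m) * fromℤ (+ suc n))   ≈⟨ -‿distribʳ-* _ _ ⟩
    fromℤ (+ m) * fromℤ -[1+ n ]        ∎

  fromℤ-* : ∀ i j → fromℤ (i ℤ.* j) ≈ fromℤ i * fromℤ j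
  fromℤ-* (+ m)    j = fromℤ-*-pos m j
  fromℤ-* -[1+ m ] j = begin
    fromℤ (ℤ.- + suc m ℤ.* j)           ≡⟨ ≡.cong fromℤ (ℤ.neg-distribˡ-* (+ suc m) j) ⟨
    fromℤ (ℤ.- (+ suc m ℤ.* j))         ≈⟨ fromℤ-neg (+ suc m ℤ.* j) ⟩
    - fromℤ (+ suc m ℤ.* j)             ≈⟨ -‿cong (fromℤ-*-pos (suc m) j) ⟩
    - (fromℤ (+ suc m) * fromℤ j)       ≈⟨ -‿distribˡ-* _ _ ⟩
    fromℤ -[1+ m ] * fromℤ j            ∎

  integerHomomorphism : ℤ.+-*-rawRing -Raw-AlmostCommutative⟶ fromCommutativeRing R
  integerHomomorphism = record
    { ⟦_⟧ = fromℤ ; +-homo = fromℤ-+ ; *-homo = fromℤ-* ; -‿homo = fromℤ-neg ; 0-homo = refl ; 1-homo = refl }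

  open Algebra.Solver.Ring ℤ.+-*-rawRing (fromCommutativeRing R) integerHomomorphism
    (λ i j → Maybe.map (reflexive ∘ ≡.cong fromℤ) (dec⇒weaklyDec ℤ._≟_ i j)) public

[1+k]*[1+n]C[1+k]≡[1+n]*nCk : ∀ n k → suc k ℕ.* (suc n C suc k) ≡ suc n ℕ.* (n C k)
[1+k]*[1+n]C[1+k]≡[1+n]*nCk zero    zero    = ≡.refl
[1+k]*[1+n]C[1+k]≡[1+n]*nCk zero    (suc k) = ℕ.*-zeroʳ (suc (suc k))
[1+k]*[1+n]C[1+k]≡[1+n]*nCk (suc n) zero    = ≡.trans (ℕ.*-identityˡ _) (≡.trans (nC1≡n (suc (suc n))) (≡.sym (ℕ.*-identityʳ _)))
[1+k]*[1+n]C[1+k]≡[1+n]*nCk (suc n) (suc k) = begin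
  suc (suc k) ℕ.* (suc (suc n) C suc (suc k))
    ≡⟨ ≡.cong (suc (suc k) ℕ.*_) (nCk+nC[k+1]≡[n+1]C[k+1] (suc n) (suc k)) ⟨
  suc (suc k) ℕ.* (c₁ ℕ.+ c₂)
    ≡⟨ solve 3 (λ k c₁ c₂ → (con 2 :+ k) :* (c₁ :+ c₂) := c₁ :+ (con 1 :+ k) :* c₁ :+ (con 2 :+ k) :* c₂) ≡.refl k c₁ c₂ ⟩
  c₁ ℕ.+ suc k ℕ.* c₁ ℕ.+ suc (suc k) ℕ.* c₂
    ≡⟨ ≡.cong₂ (λ a b → c₁ ℕ.+ a ℕ.+ b) ([1+k]*[1+n]C[1+k]≡[1+n]*nCk n k) ([1+k]*[1+n]C[1+k]≡[1+n]*nCk n (suc k)) ⟩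
  c₁ ℕ.+ suc n ℕ.* (n C k) ℕ.+ suc n ℕ.* (n C suc k)
    ≡⟨ solve 4 (λ n a b c₁ → c₁ :+ (con 1 :+ n) :* a :+ (con 1 :+ n) :* b := c₁ :+ (con 1 :+ n) :* (a :+ b)) ≡.refl n (n C k) (n C suc k) c₁ ⟩
  c₁ ℕ.+ suc n ℕ.* ((n C k) ℕ.+ (n C suc k))
    ≡⟨ ≡.cong (λ t → c₁ ℕ.+ suc n ℕ.* t) (nCk+nC[k+1]≡[n+1]C[k+1] n k) ⟩
  suc (suc n) ℕ.* c₁ ∎
  where
  open ≡.≡-Reasoning
  open +-*-Solver
  c₁ = suc n C suc k
  c₂ = suc n C suc (suc k)

prime∣pCk : ∀ {p k} → Prime p → 0 < k → k < p → p ∣ p C k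
prime∣pCk {suc n} {suc k} p-prime _ k<p
  with euclidsLemma (suc k) (suc n C suc k) p-prime
         (divides (n C k) (≡.trans ([1+k]*[1+n]C[1+k]≡[1+n]*nCk n k) (ℕ.*-comm (suc n) (n C k))))
... | inj₂ p∣C = p∣C
... | inj₁ p∣k = ⊥-elim (ℕ.<⇒≱ k<p (∣⇒≤ p∣k))

parity : ∀ n → (Σ ℕ λ m → n ≡ m ℕ.* 2) ⊎ (Σ ℕ λ m → n ≡ suc (m ℕ.* 2))
parity zero    = inj₁ (0 , ≡.refl)
parity (suc n) = [ (λ (m , n≡2m) → inj₂ (m , ≡.cong suc n≡2m)) , (λ (m , n≡1+2m) → inj₁ (suc m , ≡.cong suc n≡1+2m)) ]′ (parity n)

n<q⇒n*[1+q]<q*q : ∀ {n q} → n ℕ.< q → n ℕ.* suc q ℕ.< q ℕ.* q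
n<q⇒n*[1+q]<q*q {n} {suc r} (ℕ.s≤s n≤r) = begin-strict
  n ℕ.* suc (suc r)         ≤⟨ ℕ.*-monoˡ-≤ (suc (suc r)) n≤r ⟩
  r ℕ.* suc (suc r)         <⟨ ℕ.n<1+n _ ⟩
  suc (r ℕ.* suc (suc r))   ≡⟨ solve 1 (λ r → con 1 :+ r :* (con 2 :+ r) := (con 1 :+ r) :* (con 1 :+ r)) ≡.refl r ⟩
  suc r ℕ.* suc r           ∎
  where
  open ℕ.≤-Reasoning
  open +-*-Solver

module Frobenius {c ℓ} (R : CommutativeSemiring c ℓ) where

  open CommutativeSemiring R hiding (zero)
  open SemiringExp semiring using (_^_; ^-assocʳ; ^-congˡ)
  open SemiringMult semiring using (_×_; ×-congʳ; ×-assocˡ; ×-homo-1; ×-assoc-*)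
  open MonoidSum +-monoid using (sum; sum-cong-≋; sum-init-last; sum-replicate-zero)
  open Binomial R using (theorem; binomialTerm)
  open SetoidReasoning setoid

  module _ {p : ℕ} (p-prime : Prime p) (char : p × 1# ≈ 0#) where

    p×-annihilates : ∀ x → p × x ≈ 0#
    p×-annihilates x = begin
      p × x                 ≈⟨ ×-congʳ p (*-identityˡ x) ⟨
      p × (1# * x)          ≈⟨ ×-assoc-* p 1# x ⟨
      (p × 1#) * x          ≈⟨ *-congʳ char ⟩
      0# * x                ≈⟨ zeroˡ x ⟩
      0#                    ∎

    binomial-vanishes : ∀ {k} x → 0 < k → k < p → (p C k) × x ≈ 0#
    binomial-vanishes {k} x 0<k k<p with prime∣pCk p-prime 0<k k<p
    ... | divides m pCk≡m*p = begin
      (p C k) × x           ≡⟨ ≡.cong (_× x) (≡.trans pCk≡m*p (ℕ.*-comm m p)) ⟩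
      (p ℕ.* m) × x         ≈⟨ ×-assocˡ x p m ⟨
      p × (m × x)           ≈⟨ p×-annihilates (m × x) ⟩
      0#                    ∎

    private
      expansion-collapses : ∀ r → 2 ℕ.+ r ≡ p → ∀ x y → (x + y) ^ p ≈ x ^ p + y ^ p
      expansion-collapses r ≡.refl x y = begin
        (x + y) ^ p                              ≈⟨ theorem p x y ⟩
        term Fin.zero + sum (λ i → term (Fin.suc i))  ≈⟨ +-cong first (sum-init-last {suc r} (λ i → term (Fin.suc i))) ⟩
        y ^ p + (sum (λ i → term (Fin.suc (inject₁ i))) + term (Fin.suc (fromℕ (suc r))))
                                                 ≈⟨ +-congˡ (+-cong (trans (sum-cong-≋ {suc r} middle) (sum-replicate-zero (suc r))) last) ⟩
        y ^ p + (0# + x ^ p)                     ≈⟨ +-congˡ (+-identityˡ _) ⟩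
        y ^ p + x ^ p                            ≈⟨ +-comm _ _ ⟩
        x ^ p + y ^ p                            ∎
        where
        term = binomialTerm x y p
        first : term Fin.zero ≈ y ^ p
        first = trans (×-homo-1 _) (*-identityˡ _)
        middle : ∀ i → term (Fin.suc (inject₁ i)) ≈ 0#
        middle i = trans (reflexive (≡.cong (λ k → (p C k) × (x ^ k * y ^ (p ℕ.∸ k))) (≡.cong suc (Fin.toℕ-inject₁ i))))
                         (binomial-vanishes _ (s≤s z≤n) (s≤s (Fin.toℕ<n i)))
        last : term (Fin.suc (fromℕ (suc r))) ≈ x ^ p
        last = begin
          term (Fin.suc (fromℕ (suc r)))   ≡⟨ ≡.cong (λ k → (p C k) × (x ^ k * y ^ (p ℕ.∸ k))) (≡.cong suc (Fin.toℕ-fromℕ (suc r))) ⟩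
          (p C p) × (x ^ p * y ^ (p ℕ.∸ p)) ≡⟨ ≡.cong₂ (λ c k → c × (x ^ p * y ^ k)) (nCn≡1 p) (ℕ.n∸n≡0 p) ⟩
          1 × (x ^ p * 1#)                 ≈⟨ ×-homo-1 _ ⟩
          x ^ p * 1#                       ≈⟨ *-identityʳ _ ⟩
          x ^ p                            ∎

    ^p-homo-+ : ∀ x y → (x + y) ^ p ≈ x ^ p + y ^ p
    ^p-homo-+ = expansion-collapses _ (proj₂ (ℕ.m≤n⇒∃[o]m+o≡n (nonTrivial⇒n>1 p {{prime⇒nonTrivial p-prime}})))

    ^p^m-homo-+ : ∀ m x y → (x + y) ^ (p ℕ.^ m) ≈ x ^ (p ℕ.^ m) + y ^ (p ℕ.^ m)
    ^p^m-homo-+ zero    x y = trans (*-identityʳ _) (+-cong (sym (*-identityʳ x)) (sym (*-identityʳ y)))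
    ^p^m-homo-+ (suc m) x y = begin
      (x + y) ^ (p ℕ.* p ℕ.^ m)                 ≈⟨ ^-assocʳ (x + y) p (p ℕ.^ m) ⟨
      ((x + y) ^ p) ^ (p ℕ.^ m)                 ≈⟨ ^-congˡ (p ℕ.^ m) (^p-homo-+ x y) ⟩
      (x ^ p + y ^ p) ^ (p ℕ.^ m)               ≈⟨ ^p^m-homo-+ m (x ^ p) (y ^ p) ⟩
      (x ^ p) ^ (p ℕ.^ m) + (y ^ p) ^ (p ℕ.^ m) ≈⟨ +-cong (^-assocʳ x p (p ℕ.^ m)) (^-assocʳ y p (p ℕ.^ m)) ⟩
      x ^ (p ℕ.* p ℕ.^ m) + y ^ (p ℕ.* p ℕ.^ m) ∎

module PolynomialRoots {c ℓ} (R : CommutativeRing c ℓ) where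

  open CommutativeRing R
  open SemiringExp semiring using (_^_)
  open SetoidUnique setoid using () renaming (Unique to Distinct)
  open IntegerCoefficientSolver R using (solve; _:=_; _:+_; _:*_; _:-_; :-_; con)
  open SetoidReasoning setoid

  -- polynomials as coefficient lists, constant term first
  evalPoly : List Carrier → Carrier → Carrier
  evalPoly []       x = 0#
  evalPoly (a ∷ as) x = a + x * evalPoly as x

  quotient : Carrier → List Carrier → List Carrier
  quotient r []           = []
  quotient r (a ∷ [])     = []
  quotient r (a ∷ b ∷ as) = evalPoly (b ∷ as) r ∷ quotient r (b ∷ as)

  division : ∀ r as x → evalPoly as x ≈ (x - r) * evalPoly (quotient r as) x + evalPoly as r
  division r []           x = solve 2 (λ r x → con 0ℤ := (x :- r) :* con 0ℤ :+ con 0ℤ) refl r x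
  division r (a ∷ [])     x = solve 3 (λ a r x → a :+ x :* con 0ℤ := (x :- r) :* con 0ℤ :+ (a :+ r :* con 0ℤ)) refl a r x
  division r (a ∷ b ∷ as) x = begin
    a + x * evalPoly (b ∷ as) x                 ≈⟨ +-congˡ (*-congˡ (division r (b ∷ as) x)) ⟩
    a + x * ((x - r) * q + e)                   ≈⟨ solve 5 (λ a r x q e → a :+ x :* ((x :- r) :* q :+ e) := (x :- r) :* (e :+ x :* q) :+ (a :+ r :* e)) refl a r x q e ⟩
    (x - r) * (e + x * q) + (a + r * e)         ∎
    where
    q = evalPoly (quotient r (b ∷ as)) x
    e = evalPoly (b ∷ as) r

  Null : List Carrier → Set _
  Null = All (_≈ 0#)

  evalPoly-null : ∀ {as} x → Null as → evalPoly as x ≈ 0#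
  evalPoly-null x []            = refl
  evalPoly-null x (a≈0 ∷ as≈0) = begin
    _ + x * _      ≈⟨ +-cong a≈0 (*-congˡ (evalPoly-null x as≈0)) ⟩
    0# + x * 0#    ≈⟨ solve 1 (λ x → con 0ℤ :+ x :* con 0ℤ := con 0ℤ) refl x ⟩
    0#             ∎

  head-null : ∀ {a as} r → Null as → evalPoly (a ∷ as) r ≈ 0# → a ≈ 0#
  head-null {a} {as} r as≈0 root = begin
    a                   ≈⟨ solve 2 (λ a r → a := a :+ r :* con 0ℤ) refl a r ⟩
    a + r * 0#          ≈⟨ +-congˡ (*-congˡ (evalPoly-null r as≈0)) ⟨
    evalPoly (a ∷ as) r ≈⟨ root ⟩
    0#                 ∎

  quotient-null : ∀ r as → Null (quotient r as) → evalPoly as r ≈ 0# → Null as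
  quotient-null r []           _           _    = []
  quotient-null r (a ∷ [])     _           root = head-null r [] root ∷ []
  quotient-null r (a ∷ b ∷ as) (e≈0 ∷ q≈0) root = head-null r tail≈0 root ∷ tail≈0
    where tail≈0 = quotient-null r (b ∷ as) q≈0 e≈0

  length-quotient : ∀ r a as → suc (length (quotient r (a ∷ as))) ≡.≡ length (a ∷ as)
  length-quotient r a []       = ≡.refl
  length-quotient r a (b ∷ as) = ≡.cong suc (length-quotient r b as)

  monomial : ℕ → List Carrier
  monomial zero    = 1# ∷ []
  monomial (suc n) = 0# ∷ monomial n

  evalPoly-monomial : ∀ n x → evalPoly (monomial n) x ≈ x ^ n
  evalPoly-monomial zero    x = solve 1 (λ x → con 1ℤ :+ x :* con 0ℤ := con 1ℤ) refl x
  evalPoly-monomial (suc n) x = trans (+-identityˡ _) (*-congˡ (evalPoly-monomial n x))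

  length-monomial : ∀ n → length (monomial n) ≡.≡ suc n
  length-monomial zero    = ≡.refl
  length-monomial (suc n) = ≡.cong suc (length-monomial n)

  monomial-nonnull : ¬ 1# ≈ 0# → ∀ n → ¬ Null (monomial n)
  monomial-nonnull 1≉0 zero    (1≈0 ∷ []) = 1≉0 1≈0
  monomial-nonnull 1≉0 (suc n) (_ ∷ null) = monomial-nonnull 1≉0 n null

  module _ (no-zero-divisors : ∀ x y → x * y ≈ 0# → x ≈ 0# ⊎ y ≈ 0#) where

    length-roots<length : ∀ rs as → Distinct rs → All (λ r → evalPoly as r ≈ 0#) rs → ¬ Null as → length rs < length as
    length-roots<length []       []       _ _ nonnull = ⊥-elim (nonnull [])
    length-roots<length []       (a ∷ as) _ _ _       = s≤s z≤n
    length-roots<length (r ∷ rs) []       _ _ nonnull = ⊥-elim (nonnull [])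
    length-roots<length (r ∷ rs) (a ∷ as) (r∉rs ∷ unique) (root ∷ roots) nonnull =
      ≡.subst (suc (length rs) <_) (length-quotient r a as)
        (s≤s (length-roots<length rs (quotient r (a ∷ as)) unique (All.zipWith (uncurry quotient-root) (r∉rs , roots))
                                  (λ q≈0 → nonnull (quotient-null r (a ∷ as) q≈0 root))))
      where
      quotient-root : ∀ {s} → ¬ r ≈ s → evalPoly (a ∷ as) s ≈ 0# → evalPoly (quotient r (a ∷ as)) s ≈ 0#
      quotient-root {s} r≉s s-root with no-zero-divisors (s - r) (evalPoly (quotient r (a ∷ as)) s) (begin
        (s - r) * _                            ≈⟨ +-identityʳ _ ⟨
        (s - r) * _ + 0#                       ≈⟨ +-congˡ root ⟨
        (s - r) * _ + evalPoly (a ∷ as) r      ≈⟨ division r (a ∷ as) s ⟨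
        evalPoly (a ∷ as) s                    ≈⟨ s-root ⟩
        0#                                     ∎)
      ... | inj₂ q≈0 = q≈0
      ... | inj₁ s-r≈0 = ⊥-elim (r≉s (sym (begin
        s                ≈⟨ solve 2 (λ s r → s := (s :- r) :+ r) refl s r ⟩
        (s - r) + r      ≈⟨ +-congʳ s-r≈0 ⟩
        0# + r           ≈⟨ +-identityˡ r ⟩
        r                ∎)))

    trinomial-roots-bound : ¬ 1# ≈ 0# → ∀ n b c rs → Distinct rs →
      All (λ r → r ^ (2 ℕ.+ n) + b * r + c ≈ 0#) rs → length rs ≤ 2 ℕ.+ n
    trinomial-roots-bound 1≉0 n b c rs unique roots =
      ℕ.≤-pred (≡.subst (length rs <_) (≡.cong (2 ℕ.+_) (length-monomial n))
        (length-roots<length rs (c ∷ b ∷ monomial n) unique (All.map as-evalPoly roots) nonnull))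
      where
      nonnull : ¬ Null (c ∷ b ∷ monomial n)
      nonnull (_ ∷ _ ∷ null) = monomial-nonnull 1≉0 n null
      as-evalPoly : ∀ {r} → r ^ (2 ℕ.+ n) + b * r + c ≈ 0# → evalPoly (c ∷ b ∷ monomial n) r ≈ 0#
      as-evalPoly {r} root = begin
        c + r * (b + r * evalPoly (monomial n) r)  ≈⟨ +-congˡ (*-congˡ (+-congˡ (*-congˡ (evalPoly-monomial n r)))) ⟩
        c + r * (b + r * r ^ n)                    ≈⟨ solve 4 (λ c r b rn → c :+ r :* (b :+ r :* rn) := r :* (r :* rn) :+ b :* r :+ c) refl c r b (r ^ n) ⟩
        r * (r * r ^ n) + b * r + c                ≈⟨ root ⟩
        0#                                         ∎

module FibreCounting {A B : Set} (f : A → B) (_≟_ : DecidableEquality B) where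

  open ≡ using (refl; sym)

  fibre : List A → B → List A
  fibre xs y = filter (λ x → f x ≟ y) xs

  fibreSum : List B → List A → ℕ
  fibreSum ys xs = ℕ.sum (map (λ y → length (fibre xs y)) ys)

  private
    length-fibre-∷ : ∀ x xs y → length (fibre xs y) ≤ length (fibre (x ∷ xs) y)
    length-fibre-∷ x xs y with f x ≟ y
    ... | yes _ = ℕ.n≤1+n _
    ... | no  _ = ℕ.≤-refl

    length-fibre-hit : ∀ x xs y → f x ≡ y → suc (length (fibre xs y)) ≤ length (fibre (x ∷ xs) y)
    length-fibre-hit x xs y fx≡y with f x ≟ y
    ... | yes _     = ℕ.≤-refl
    ... | no  fx≢y = contradiction fx≡y fx≢y

    fibreSum-∷ : ∀ ys x xs → fibreSum ys xs ≤ fibreSum ys (x ∷ xs)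
    fibreSum-∷ []       x xs = z≤n
    fibreSum-∷ (y ∷ ys) x xs = ℕ.+-mono-≤ (length-fibre-∷ x xs y) (fibreSum-∷ ys x xs)

    fibreSum-hit : ∀ ys x xs → f x ∈ ys → suc (fibreSum ys xs) ≤ fibreSum ys (x ∷ xs)
    fibreSum-hit (y ∷ ys) x xs (here fx≡y) = ℕ.+-mono-≤ (length-fibre-hit x xs y fx≡y) (fibreSum-∷ ys x xs)
    fibreSum-hit (y ∷ ys) x xs (there fx∈ys) =
      ℕ.≤-trans (ℕ.≤-reflexive (sym (ℕ.+-suc _ _)))
                (ℕ.+-mono-≤ (length-fibre-∷ x xs y) (fibreSum-hit ys x xs fx∈ys))

    length≤fibreSum : ∀ ys xs → (∀ {x} → x ∈ xs → f x ∈ ys) → length xs ≤ fibreSum ys xs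
    length≤fibreSum ys []       _     = z≤n
    length≤fibreSum ys (x ∷ xs) maps = ℕ.≤-trans (s≤s (length≤fibreSum ys xs (maps ∘ there)))
                                                  (fibreSum-hit ys x xs (maps (here refl)))

    fibreSum≤ : ∀ ys xs c → (∀ y → length (fibre xs y) ≤ c) → fibreSum ys xs ≤ length ys ℕ.* c
    fibreSum≤ []       xs c bound = z≤n
    fibreSum≤ (y ∷ ys) xs c bound = ℕ.+-mono-≤ (bound y) (fibreSum≤ ys xs c bound)

  length≤length*fibreBound : ∀ ys xs c → (∀ {x} → x ∈ xs → f x ∈ ys) →
                             (∀ y → length (fibre xs y) ≤ c) → length xs ≤ length ys ℕ.* c
  length≤length*fibreBound ys xs c maps bound = ℕ.≤-trans (length≤fibreSum ys xs maps) (fibreSum≤ ys xs c bound)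

module FiniteFieldProperties {q : ℕ} (K : FiniteField q) where

  open ≡ using (refl; sym; trans; cong; cong₂; subst; module ≡-Reasoning)

  open FiniteField K

  commutativeRing : CommutativeRing 0ℓ 0ℓ
  commutativeRing = record { isCommutativeRing = isCommutativeRing }

  open CommutativeRing commutativeRing
    using (+-identityʳ; -‿inverseʳ; *-assoc; *-comm; *-identityˡ; *-identityʳ; zeroˡ; zeroʳ; semiring)
  open SemiringMult semiring using (_×_; ×1-homo-*)
  open SemiringExp semiring using (_^_)
  open IntegerCoefficientSolver commutativeRing using (solve; _:=_; _:+_; _:*_; :-_; con)

  index : Carrier → Fin q
  index = Inverse.to card

  element : Fin q → Carrier
  element = Inverse.from card

  element-index : ∀ x → element (index x) ≡ x
  element-index x = Inverse.inverseʳ card refl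

  index-element : ∀ i → index (element i) ≡ i
  index-element i = Inverse.inverseˡ card refl

  infix 4 _≟_
  _≟_ : DecidableEquality Carrier
  x ≟ y with index x Fin.≟ index y
  ... | yes eq = yes (trans (sym (element-index x)) (trans (cong element eq) (element-index y)))
  ... | no  ne = no (ne ∘ cong index)

  elements : List Carrier
  elements = tabulate element

  ∈-elements : ∀ x → x ∈ elements
  ∈-elements x = subst (_∈ elements) (element-index x) (∈-tabulate⁺ (index x))

  elements-unique : Unique elements
  elements-unique = Unique.tabulate⁺ (λ eq → trans (sym (index-element _)) (trans (cong index eq) (index-element _)))

  length-elements : length elements ≡ q
  length-elements = List.length-tabulate element

  1≢0 : 1# ≢ 0#
  1≢0 = 0≢1 ∘ sym

  no-zero-divisors : ∀ x y → x * y ≡ 0# → x ≡ 0# ⊎ y ≡ 0#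
  no-zero-divisors x y xy≡0 with x ≟ 0#
  ... | yes x≡0 = inj₁ x≡0
  ... | no  x≢0 = inj₂ (begin
    y                  ≡⟨ *-identityˡ y ⟨
    1# * y             ≡⟨ cong (_* y) (⁻¹-inverse x x≢0) ⟨
    (x * x ⁻¹) * y     ≡⟨ cong (_* y) (*-comm x (x ⁻¹)) ⟩
    (x ⁻¹ * x) * y     ≡⟨ *-assoc (x ⁻¹) x y ⟩
    x ⁻¹ * (x * y)     ≡⟨ cong (x ⁻¹ *_) xy≡0 ⟩
    x ⁻¹ * 0#          ≡⟨ zeroʳ _ ⟩
    0#                 ∎)
    where open ≡-Reasoning

  module Reindexing {_∙_ : Carrier → Carrier → Carrier} {ε : Carrier} (isCM : IsCommutativeMonoid _≡_ _∙_ ε) where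

    monoid : CommutativeMonoid 0ℓ 0ℓ
    monoid = record { isCommutativeMonoid = isCM }

    open CommutativeMonoidSum monoid public
      using (sum; ∑-permute; ∑-distrib-+; sum-replicate; sum-remove; sum-cong-≗; sum-replicate-zero)

    ∑ : (Carrier → Carrier) → Carrier
    ∑ f = sum (f ∘ element)

    ∑-reindex : ∀ (φ ψ : Carrier → Carrier) → (∀ x → φ (ψ x) ≡ x) → (∀ x → ψ (φ x) ≡ x) →
                ∀ f → ∑ f ≡ ∑ (f ∘ φ)
    ∑-reindex φ ψ φψ ψφ f = trans (∑-permute (f ∘ element) π)
                                  (sum-cong-≗ (cong f ∘ element-index ∘ φ ∘ element))
      where
      π = permutation (index ∘ φ ∘ element) (index ∘ ψ ∘ element)
            (λ i → trans (cong (index ∘ φ) (element-index _)) (trans (cong index (φψ _)) (index-element i)))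
            (λ i → trans (cong (index ∘ ψ) (element-index _)) (trans (cong index (ψφ _)) (index-element i)))

  module Additive = Reindexing (IsCommutativeRing.+-isCommutativeMonoid isCommutativeRing)
  module Multiplicative = Reindexing (IsCommutativeRing.*-isCommutativeMonoid isCommutativeRing)

  q×1≡0 : q × 1# ≡ 0#
  q×1≡0 = begin
    q × 1#                 ≡⟨ solve 2 (λ s n → n := s :+ n :+ :- s) refl S (q × 1#) ⟩
    S + q × 1# + - S       ≡⟨ cong (_+ - S) shift ⟨
    S + - S                ≡⟨ -‿inverseʳ S ⟩
    0#                     ∎
    where
    open ≡-Reasoning
    open Additive using (∑; ∑-reindex; ∑-distrib-+; sum-replicate)
    S = ∑ (λ x → x)
    shift : S ≡ S + q × 1#
    shift = begin
      S                          ≡⟨ ∑-reindex (_+ 1#) (_+ - 1#) (λ x → solve 1 (λ x → x :+ :- con 1ℤ :+ con 1ℤ := x) refl x)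
                                                                  (λ x → solve 1 (λ x → x :+ con 1ℤ :+ :- con 1ℤ := x) refl x) (λ x → x) ⟩
      ∑ (λ x → x + 1#)           ≡⟨ ∑-distrib-+ {q} element (λ _ → 1#) ⟩
      S + Additive.sum {q} (λ _ → 1#) ≡⟨ cong (S +_) (sum-replicate q) ⟩
      S + q × 1#                 ∎

  ×1-homo-^ : ∀ p k → (p ℕ.^ k) × 1# ≡ (p × 1#) ^ k
  ×1-homo-^ p zero    = +-identityʳ 1#
  ×1-homo-^ p (suc k) = trans (×1-homo-* p (p ℕ.^ k)) (cong ((p × 1#) *_) (×1-homo-^ p k))

  ^≡0⇒≡0 : ∀ x k → x ^ suc k ≡ 0# → x ≡ 0#
  ^≡0⇒≡0 x zero    x¹≡0 = trans (sym (*-identityʳ x)) x¹≡0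
  ^≡0⇒≡0 x (suc k) xᵏ≡0 with no-zero-divisors x _ xᵏ≡0
  ... | inj₁ x≡0 = x≡0
  ... | inj₂ eq  = ^≡0⇒≡0 x k eq

  p×1≡0 : ∀ {p k} → q ≡ p ℕ.^ suc k → p × 1# ≡ 0#
  p×1≡0 {p} {k} q≡pᵏ = ^≡0⇒≡0 (p × 1#) k (trans (sym (×1-homo-^ p (suc k))) (trans (cong (_× 1#) (sym q≡pᵏ)) q×1≡0))

  private
    unitPart : Carrier → Carrier
    unitPart x with x ≟ 0#
    ... | yes _ = 1#
    ... | no  _ = x

    unitPart-≢0 : ∀ x → unitPart x ≢ 0#
    unitPart-≢0 x with x ≟ 0#
    ... | yes _   = 1≢0
    ... | no  x≢0 = x≢0

    ∏ = Multiplicative.∑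

    ∏-≢0 : ∀ {n} (f : Fin n → Carrier) → (∀ i → f i ≢ 0#) → Multiplicative.sum f ≢ 0#
    ∏-≢0 {zero}  f _    = 1≢0
    ∏-≢0 {suc n} f f≢0 eq with no-zero-divisors _ _ eq
    ... | inj₁ f₀≡0 = f≢0 Fin.zero f₀≡0
    ... | inj₂ rest = ∏-≢0 (f ∘ Fin.suc) (f≢0 ∘ Fin.suc) rest

    ∏-single : ∀ {n} (t : Fin n → Carrier) i → (∀ j → j ≢ i → t j ≡ 1#) → Multiplicative.sum t ≡ t i
    ∏-single {suc n} t i ones = begin
      Multiplicative.sum t                           ≡⟨ Multiplicative.sum-remove {i = i} t ⟩
      t i * Multiplicative.sum (t ∘ punchIn i)       ≡⟨ cong (t i *_) (Multiplicative.sum-cong-≗ (λ j → ones _ (Fin.punchInᵢ≢i i j))) ⟩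
      t i * Multiplicative.sum {n} (λ _ → 1#)        ≡⟨ cong (t i *_) (Multiplicative.sum-replicate-zero n) ⟩
      t i * 1#                                       ≡⟨ *-identityʳ _ ⟩
      t i                                            ∎
      where open ≡-Reasoning

    module _ (c : Carrier) (c≢0 : c ≢ 0#) where

      correction : Carrier → Carrier
      correction x with x ≟ 0#
      ... | yes _ = c
      ... | no  _ = 1#

      c*unitPart : ∀ x → c * unitPart x ≡ unitPart (c * x) * correction x
      c*unitPart x with x ≟ 0# | c * x ≟ 0#
      ... | yes _   | yes _     = trans (*-identityʳ c) (sym (*-identityˡ c))
      ... | yes x≡0 | no cx≢0   = ⊥-elim (cx≢0 (trans (cong (c *_) x≡0) (zeroʳ c)))
      ... | no x≢0  | yes cx≡0  = ⊥-elim ([ c≢0 , x≢0 ]′ (no-zero-divisors c x cx≡0))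
      ... | no _    | no  _     = sym (*-identityʳ _)

      ∏-correction : ∏ correction ≡ c
      ∏-correction = trans (∏-single (correction ∘ element) (index 0#) one-off-zero) at-zero
        where
        at-zero : correction (element (index 0#)) ≡ c
        at-zero with element (index 0#) ≟ 0#
        ... | yes _ = refl
        ... | no ne = ⊥-elim (ne (element-index 0#))
        one-off-zero : ∀ j → j ≢ index 0# → correction (element j) ≡ 1#
        one-off-zero j j≢0 with element j ≟ 0#
        ... | no  _  = refl
        ... | yes eq = ⊥-elim (j≢0 (trans (sym (index-element j)) (cong index eq)))

      -- multiplication by c permutes K, and c · unitPart x = unitPart (c x) except at x = 0
      c^q*∏≡∏*c : c ^ q * ∏ unitPart ≡ ∏ unitPart * c
      c^q*∏≡∏*c = begin
        c ^ q * ∏ unitPart                          ≡⟨ cong (_* ∏ unitPart) (Multiplicative.sum-replicate q) ⟨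
        ∏ (λ _ → c) * ∏ unitPart                    ≡⟨ Multiplicative.∑-distrib-+ {q} (λ _ → c) (unitPart ∘ element) ⟨
        ∏ (λ x → c * unitPart x)                    ≡⟨ Multiplicative.sum-cong-≗ (c*unitPart ∘ element) ⟩
        ∏ (λ x → unitPart (c * x) * correction x)   ≡⟨ Multiplicative.∑-distrib-+ {q} (unitPart ∘ (c *_) ∘ element) (correction ∘ element) ⟩
        ∏ (unitPart ∘ (c *_)) * ∏ correction        ≡⟨ cong₂ _*_ (Multiplicative.∑-reindex (c *_) (c ⁻¹ *_) cancel cancel′ unitPart) (sym ∏-correction) ⟨
        ∏ unitPart * c                              ∎
        where
        open ≡-Reasoning
        cancel : ∀ x → c * (c ⁻¹ * x) ≡ x
        cancel x = trans (sym (*-assoc c (c ⁻¹) x)) (trans (cong (_* x) (⁻¹-inverse c c≢0)) (*-identityˡ x))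
        cancel′ : ∀ x → c ⁻¹ * (c * x) ≡ x
        cancel′ x = trans (sym (*-assoc (c ⁻¹) c x)) (trans (cong (_* x) (trans (*-comm (c ⁻¹) c) (⁻¹-inverse c c≢0))) (*-identityˡ x))

  q≡suc[pred-q] : q ≡ suc (ℕ.pred q)
  q≡suc[pred-q] = nonempty (index 0#)
    where
    nonempty : ∀ {n} → Fin n → n ≡ suc (ℕ.pred n)
    nonempty Fin.zero    = refl
    nonempty (Fin.suc _) = refl

  fermat : ∀ x → x ^ q ≡ x
  fermat x with x ≟ 0#
  ... | yes refl = subst (λ n → 0# ^ n ≡ 0#) (sym q≡suc[pred-q]) (zeroˡ _)
  ... | no  x≢0  = begin
    x ^ q                       ≡⟨ *-identityʳ _ ⟨
    x ^ q * 1#                  ≡⟨ cong (x ^ q *_) (⁻¹-inverse G G≢0) ⟨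
    x ^ q * (G * G ⁻¹)          ≡⟨ *-assoc (x ^ q) G (G ⁻¹) ⟨
    (x ^ q * G) * G ⁻¹          ≡⟨ cong (_* G ⁻¹) (trans (c^q*∏≡∏*c x x≢0) (*-comm G x)) ⟩
    (x * G) * G ⁻¹              ≡⟨ *-assoc x G (G ⁻¹) ⟩
    x * (G * G ⁻¹)              ≡⟨ cong (x *_) (⁻¹-inverse G G≢0) ⟩
    x * 1#                      ≡⟨ *-identityʳ x ⟩
    x                           ∎
    where
    open ≡-Reasoning
    G = ∏ unitPart
    G≢0 : G ≢ 0#
    G≢0 = ∏-≢0 (unitPart ∘ element) (unitPart-≢0 ∘ element)

  1+1≢0 : ¬ 2 ∣ q → 1# + 1# ≢ 0#
  1+1≢0 q-odd 1+1≡0 with parity q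
  ... | inj₁ (m , q≡m*2)   = q-odd (divides m q≡m*2)
  ... | inj₂ (m , q≡1+m*2) = 1≢0 (begin
    1#                          ≡⟨ solve 1 (λ x → con 1ℤ := con 1ℤ :+ x :* con 0ℤ) refl (m × 1#) ⟩
    1# + m × 1# * 0#            ≡⟨ cong (λ t → 1# + m × 1# * t) 1+1≡0 ⟨
    1# + m × 1# * (1# + 1#)     ≡⟨ cong (λ t → 1# + m × 1# * (1# + t)) (+-identityʳ 1#) ⟨
    1# + m × 1# * 2 × 1#        ≡⟨ cong (1# +_) (×1-homo-* m 2) ⟨
    suc (m ℕ.* 2) × 1#          ≡⟨ cong (_× 1#) q≡1+m*2 ⟨
    q × 1#                      ≡⟨ q×1≡0 ⟩
    0#                          ∎)
    where open ≡-Reasoning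

module QuadraticExtension {q : ℕ} (K : FiniteField q) (α : FiniteField.Carrier K) where

  open ≡ using (refl; sym; trans; cong; cong₂; subst; module ≡-Reasoning)

  open FiniteField K
  open Over K α
  open FiniteFieldProperties K
  private module KS = IntegerCoefficientSolver commutativeRing

  open CommutativeRing commutativeRing
    using (+-assoc; +-comm; +-identityˡ; +-identityʳ; -‿inverseˡ; -‿inverseʳ)

  *L-assoc : ∀ u v w → (u *L v) *L w ≡ u *L (v *L w)
  *L-assoc (x₁ , y₁) (x₂ , y₂) (x₃ , y₃) = cong₂ _,_
    (solve 7 (λ a x₁ y₁ x₂ y₂ x₃ y₃ →
       (x₁ :* x₂ :+ a :* (y₁ :* y₂)) :* x₃ :+ a :* ((x₁ :* y₂ :+ y₁ :* x₂) :* y₃)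
       := x₁ :* (x₂ :* x₃ :+ a :* (y₂ :* y₃)) :+ a :* (y₁ :* (x₂ :* y₃ :+ y₂ :* x₃))) refl α x₁ y₁ x₂ y₂ x₃ y₃)
    (solve 7 (λ a x₁ y₁ x₂ y₂ x₃ y₃ →
       (x₁ :* x₂ :+ a :* (y₁ :* y₂)) :* y₃ :+ (x₁ :* y₂ :+ y₁ :* x₂) :* x₃
       := x₁ :* (x₂ :* y₃ :+ y₂ :* x₃) :+ y₁ :* (x₂ :* x₃ :+ a :* (y₂ :* y₃))) refl α x₁ y₁ x₂ y₂ x₃ y₃)
    where open KS

  *L-comm : ∀ u v → u *L v ≡ v *L u
  *L-comm (x₁ , y₁) (x₂ , y₂) = cong₂ _,_
    (solve 5 (λ a x₁ y₁ x₂ y₂ → x₁ :* x₂ :+ a :* (y₁ :* y₂) := x₂ :* x₁ :+ a :* (y₂ :* y₁)) refl α x₁ y₁ x₂ y₂)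
    (solve 4 (λ x₁ y₁ x₂ y₂ → x₁ :* y₂ :+ y₁ :* x₂ := x₂ :* y₁ :+ y₂ :* x₁) refl x₁ y₁ x₂ y₂)
    where open KS

  *L-identityˡ : ∀ u → 1L *L u ≡ u
  *L-identityˡ (x , y) = cong₂ _,_
    (solve 3 (λ a x y → con 1ℤ :* x :+ a :* (con 0ℤ :* y) := x) refl α x y)
    (solve 2 (λ x y → con 1ℤ :* y :+ con 0ℤ :* x := y) refl x y)
    where open KS

  *L-distribˡ : ∀ u v w → u *L (v +L w) ≡ (u *L v) +L (u *L w)
  *L-distribˡ (x₁ , y₁) (x₂ , y₂) (x₃ , y₃) = cong₂ _,_
    (solve 7 (λ a x₁ y₁ x₂ y₂ x₃ y₃ → x₁ :* (x₂ :+ x₃) :+ a :* (y₁ :* (y₂ :+ y₃))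
       := (x₁ :* x₂ :+ a :* (y₁ :* y₂)) :+ (x₁ :* x₃ :+ a :* (y₁ :* y₃))) refl α x₁ y₁ x₂ y₂ x₃ y₃)
    (solve 6 (λ x₁ y₁ x₂ y₂ x₃ y₃ → x₁ :* (y₂ :+ y₃) :+ y₁ :* (x₂ :+ x₃)
       := (x₁ :* y₂ :+ y₁ :* x₂) :+ (x₁ :* y₃ :+ y₁ :* x₃)) refl x₁ y₁ x₂ y₂ x₃ y₃)
    where open KS

  L-isCommutativeRing : IsCommutativeRing _≡_ _+L_ _*L_ -L_ 0L 1L
  L-isCommutativeRing = record
    { isRing = record
      { +-isAbelianGroup = record
        { isGroup = record
          { isMonoid = record
            { isSemigroup = record
              { isMagma = record { isEquivalence = ≡.isEquivalence ; ∙-cong = cong₂ _+L_ }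
              ; assoc = λ (a , b) (c , d) (e , f) → cong₂ _,_ (+-assoc a c e) (+-assoc b d f) }
            ; identity = (λ (a , b) → cong₂ _,_ (+-identityˡ a) (+-identityˡ b))
                       , (λ (a , b) → cong₂ _,_ (+-identityʳ a) (+-identityʳ b)) }
          ; inverse = (λ (a , b) → cong₂ _,_ (-‿inverseˡ a) (-‿inverseˡ b))
                    , (λ (a , b) → cong₂ _,_ (-‿inverseʳ a) (-‿inverseʳ b))
          ; ⁻¹-cong = cong (λ u → -L u) }
        ; comm = λ (a , b) (c , d) → cong₂ _,_ (+-comm a c) (+-comm b d) }
      ; *-cong = cong₂ _*L_
      ; *-assoc = *L-assoc
      ; *-identity = *L-identityˡ , (λ u → trans (*L-comm u 1L) (*L-identityˡ u))
      ; distrib = *L-distribˡ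
                , (λ u v w → trans (*L-comm (v +L w) u) (trans (*L-distribˡ u v w) (cong₂ _+L_ (*L-comm u v) (*L-comm u w)))) }
    ; *-comm = *L-comm }

  L-commutativeRing : CommutativeRing 0ℓ 0ℓ
  L-commutativeRing = record { isCommutativeRing = L-isCommutativeRing }

  open AbelianGroupProperties (CommutativeRing.+-abelianGroup L-commutativeRing) public
    using (x∙y⁻¹≈ε⇒x≈y; inverseˡ-unique)

  infix 4 _≟L_
  _≟L_ : DecidableEquality L
  (a , b) ≟L (c , d) with a ≟ c | b ≟ d
  ... | yes refl | yes refl = yes refl
  ... | no  a≢c  | _        = no (a≢c ∘ cong proj₁)
  ... | yes _    | no  b≢d  = no (b≢d ∘ cong proj₂)

  1L≢0L : 1L ≢ 0L
  1L≢0L = 1≢0 ∘ cong proj₁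

  elementsL : List L
  elementsL = cartesianProduct elements elements

  elementsL-unique : Unique elementsL
  elementsL-unique = Unique.cartesianProduct⁺ elements-unique elements-unique

  length-elementsL : length elementsL ≡ q ℕ.* q
  length-elementsL = trans (length-cartesianProduct elements elements) (cong₂ ℕ._*_ length-elements length-elements)
    where
    length-cartesianProduct : ∀ {A B : Set} (xs : List A) (ys : List B) → length (cartesianProduct xs ys) ≡ length xs ℕ.* length ys
    length-cartesianProduct []       ys = refl
    length-cartesianProduct (x ∷ xs) ys = trans (List.length-++ (map (x ,_) ys))
                                                (cong₂ ℕ._+_ (List.length-map (x ,_) ys) (length-cartesianProduct xs ys))

  norm : L → Carrier
  norm (x , y) = x * x + - (α * (y * y))

  module Field (α-nonsquare : IsNonsquare α) where

    norm-≢0 : ∀ z → z ≢ 0L → norm z ≢ 0#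
    norm-≢0 (x , y) z≢0 norm≡0 with y ≟ 0#
    ... | yes refl = [ x≢0 , x≢0 ]′ (no-zero-divisors x x (begin
      x * x                         ≡⟨ solve 2 (λ a x → x :* x := x :* x :+ :- (a :* (con 0ℤ :* con 0ℤ))) refl α x ⟩
      x * x + - (α * (0# * 0#))     ≡⟨ norm≡0 ⟩
      0#                            ∎))
      where
      open ≡-Reasoning
      open KS
      x≢0 : x ≢ 0#
      x≢0 refl = z≢0 refl
    ... | no y≢0 = α-nonsquare (x * y ⁻¹) (begin
      (x * i) * (x * i)                              ≡⟨ solve 4 (λ x y i a → (x :* i) :* (x :* i) := (x :* x :+ :- (a :* (y :* y))) :* (i :* i) :+ a :* ((y :* i) :* (y :* i))) refl x y i α ⟩
      norm (x , y) * (i * i) + α * ((y * i) * (y * i)) ≡⟨ cong₂ (λ n u → n * (i * i) + α * (u * u)) norm≡0 (⁻¹-inverse y y≢0) ⟩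
      0# * (i * i) + α * (1# * 1#)                   ≡⟨ solve 2 (λ i a → con 0ℤ :* (i :* i) :+ a :* (con 1ℤ :* con 1ℤ) := a) refl i α ⟩
      α                                              ∎)
      where
      open ≡-Reasoning
      open KS
      i = y ⁻¹

    invL-inverse : ∀ z → z ≢ 0L → z *L invL z ≡ 1L
    invL-inverse (x , y) z≢0 = cong₂ _,_
      (trans (solve 4 (λ a x y i → x :* (x :* i) :+ a :* (y :* (:- y :* i)) := (x :* x :+ :- (a :* (y :* y))) :* i) refl α x y i)
             (⁻¹-inverse _ (norm-≢0 (x , y) z≢0)))
      (solve 3 (λ x y i → x :* (:- y :* i) :+ y :* (x :* i) := con 0ℤ) refl x y i)
      where
      open KS
      i = norm (x , y) ⁻¹

    L-no-zero-divisors : ∀ u v → u *L v ≡ 0L → u ≡ 0L ⊎ v ≡ 0L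
    L-no-zero-divisors u v uv≡0 with u ≟L 0L
    ... | yes u≡0 = inj₁ u≡0
    ... | no  u≢0 = inj₂ (begin
      v                        ≡⟨ solve 1 (λ v → con 1ℤ :* v := v) refl v ⟨
      1L *L v                  ≡⟨ cong (_*L v) (trans (*L-comm (invL u) u) (invL-inverse u u≢0)) ⟨
      (invL u *L u) *L v       ≡⟨ solve 3 (λ i u v → (i :* u) :* v := i :* (u :* v)) refl (invL u) u v ⟩
      invL u *L (u *L v)       ≡⟨ cong (invL u *L_) uv≡0 ⟩
      invL u *L 0L             ≡⟨ solve 1 (λ i → i :* con 0ℤ := con 0ℤ) refl (invL u) ⟩
      0L                       ∎)
      where
      open ≡-Reasoning
      open IntegerCoefficientSolver L-commutativeRing

  module Conjugation (α-nonsquare : IsNonsquare α) {p k : ℕ} (p-prime : Prime p) (q≡pᵏ : q ≡ p ℕ.^ suc k) where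

    open Field α-nonsquare
    open CommutativeRing L-commutativeRing using (commutativeSemiring; semiring)
    open SemiringMult semiring using (_×_)
    open SemiringExp semiring using (_^_)
    open CommutativeSemiringExp commutativeSemiring using (^-distrib-*)
    open Frobenius commutativeSemiring using (^p^m-homo-+)
    open PolynomialRoots L-commutativeRing using (trinomial-roots-bound)
    private module LS = IntegerCoefficientSolver L-commutativeRing
    private module K× = SemiringMult (CommutativeRing.semiring commutativeRing)
    private module K^ = SemiringExp (CommutativeRing.semiring commutativeRing)

    ^L≗^ : ∀ z n → z ^L n ≡ z ^ n
    ^L≗^ z zero    = refl
    ^L≗^ z (suc n) = cong (z *L_) (^L≗^ z n)

    ι-×1 : ∀ n → n × 1L ≡ ι (n K×.× 1#)
    ι-×1 zero    = refl
    ι-×1 (suc n) = trans (cong (1L +L_) (ι-×1 n)) (cong (1# + n K×.× 1# ,_) (+-identityˡ 0#))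

    conj≗^q : ∀ z → conj z ≡ z ^ (p ℕ.^ suc k)
    conj≗^q z = trans (^L≗^ z q) (cong (z ^_) q≡pᵏ)

    conj-+ : ∀ u v → conj (u +L v) ≡ conj u +L conj v
    conj-+ u v = begin
      conj (u +L v)                                ≡⟨ conj≗^q (u +L v) ⟩
      (u +L v) ^ (p ℕ.^ suc k)                     ≡⟨ ^p^m-homo-+ p-prime p×1≡0L (suc k) u v ⟩
      (u ^ (p ℕ.^ suc k)) +L (v ^ (p ℕ.^ suc k))   ≡⟨ cong₂ _+L_ (conj≗^q u) (conj≗^q v) ⟨
      conj u +L conj v                             ∎
      where
      open ≡-Reasoning
      p×1≡0L : p × 1L ≡ 0L
      p×1≡0L = trans (ι-×1 p) (cong ι (p×1≡0 {p} {k} q≡pᵏ))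

    conj-* : ∀ u v → conj (u *L v) ≡ conj u *L conj v
    conj-* u v = trans (^L≗^ (u *L v) q) (trans (^-distrib-* u v q) (sym (cong₂ _*L_ (^L≗^ u q) (^L≗^ v q))))

    conj-ι : ∀ c → conj (ι c) ≡ ι c
    conj-ι c = trans (ι-^ q) (cong ι (fermat c))
      where
      ι-^ : ∀ n → ι c ^L n ≡ ι (c K^.^ n)
      ι-^ zero    = refl
      ι-^ (suc n) = trans (cong (ι c *L_) (ι-^ n))
        (cong₂ _,_ (solve 3 (λ a c cⁿ → c :* cⁿ :+ a :* (con 0ℤ :* con 0ℤ) := c :* cⁿ) refl α c (c K^.^ n))
                   (solve 2 (λ c cⁿ → c :* con 0ℤ :+ con 0ℤ :* cⁿ := con 0ℤ) refl c (c K^.^ n)))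
        where open KS

    2≤q : 2 ℕ.≤ q
    2≤q = subst (2 ℕ.≤_) (sym q≡pᵏ)
            (ℕ.≤-trans (nonTrivial⇒n>1 p {{prime⇒nonTrivial p-prime}}) (ℕ.m≤m*n p (p ℕ.^ k) {{ℕ.m^n≢0 p k {{prime⇒nonZero p-prime}}}}))

    private
      m = proj₁ (ℕ.m≤n⇒∃[o]m+o≡n 2≤q)

      q≡2+m : q ≡ 2 ℕ.+ m
      q≡2+m = sym (proj₂ (ℕ.m≤n⇒∃[o]m+o≡n 2≤q))

    decompose : ∀ a b → (a , b) ≡ ι a +L (β *L ι b)
    decompose a b = cong₂ _,_
      (solve 3 (λ a b al → a := a :+ (con 0ℤ :* b :+ al :* (con 1ℤ :* con 0ℤ))) refl a b α)
      (solve 2 (λ a b → b := con 0ℤ :+ (con 0ℤ :* con 0ℤ :+ con 1ℤ :* b)) refl a b)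
      where open KS

    conj-decompose : ∀ a b → conj (a , b) ≡ ι a +L (conj β *L ι b)
    conj-decompose a b = begin
      conj (a , b)                          ≡⟨ cong conj (decompose a b) ⟩
      conj (ι a +L (β *L ι b))              ≡⟨ conj-+ (ι a) (β *L ι b) ⟩
      conj (ι a) +L conj (β *L ι b)         ≡⟨ cong (conj (ι a) +L_) (conj-* β (ι b)) ⟩
      conj (ι a) +L (conj β *L conj (ι b))  ≡⟨ cong₂ (λ u v → u +L (conj β *L v)) (conj-ι a) (conj-ι b) ⟩
      ι a +L (conj β *L ι b)                ∎
      where open ≡-Reasoning

    -- otherwise every element of L would be a root of x^q − x
    conj-β≢β : conj β ≢ β
    conj-β≢β conj-β≡β = ℕ.<⇒≱ q<q*q (subst (ℕ._≤ q) length-elementsL (subst (length elementsL ℕ.≤_) (sym q≡2+m) at-most-2+m-roots))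
      where
      q<q*q : q ℕ.< q ℕ.* q
      q<q*q = subst (λ n → n ℕ.< n ℕ.* n) (sym q≡2+m) (ℕ.m<m*n (2 ℕ.+ m) (2 ℕ.+ m) (ℕ.s≤s (ℕ.s≤s ℕ.z≤n)))
      conj-id : ∀ z → conj z ≡ z
      conj-id (a , b) = trans (conj-decompose a b) (trans (cong (λ u → ι a +L (u *L ι b)) conj-β≡β) (sym (decompose a b)))
      root : ∀ z → ((z ^ (2 ℕ.+ m)) +L ((-L 1L) *L z)) +L 0L ≡ 0L
      root z = begin
        ((z ^ (2 ℕ.+ m)) +L ((-L 1L) *L z)) +L 0L  ≡⟨ cong (λ w → (w +L ((-L 1L) *L z)) +L 0L) (trans (sym (^L≗^ z (2 ℕ.+ m))) (trans (cong (z ^L_) (sym q≡2+m)) (conj-id z))) ⟩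
        (z +L ((-L 1L) *L z)) +L 0L              ≡⟨ solve 1 (λ z → z :+ :- con 1ℤ :* z :+ con 0ℤ := con 0ℤ) refl z ⟩
        0L                                       ∎
        where
        open ≡-Reasoning
        open LS
      at-most-2+m-roots : length elementsL ℕ.≤ 2 ℕ.+ m
      at-most-2+m-roots = trinomial-roots-bound L-no-zero-divisors 1L≢0L m (-L 1L) 0L elementsL elementsL-unique (All.tabulate (λ {z} _ → root z))

    conj-β*conj-β : conj β *L conj β ≡ β *L β
    conj-β*conj-β = trans (sym (conj-* β β)) (trans (cong conj β*β) (trans (conj-ι α) (sym β*β)))
      where
      β*β : β *L β ≡ ι α
      β*β = cong₂ _,_ (solve 1 (λ a → con 0ℤ :* con 0ℤ :+ a :* (con 1ℤ :* con 1ℤ) := a) refl α)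
                      (solve 0 (con 0ℤ :* con 1ℤ :+ con 1ℤ :* con 0ℤ := con 0ℤ) refl)
        where open KS

    difference-of-squares : (conj β -L β) *L (conj β +L β) ≡ 0L
    difference-of-squares = begin
      (conj β -L β) *L (conj β +L β)    ≡⟨ LS.solve 2 (λ c b → (c :- b) :* (c :+ b) := c :* c :- b :* b) refl (conj β) β ⟩
      (conj β *L conj β) -L (β *L β)    ≡⟨ cong (_-L (β *L β)) conj-β*conj-β ⟩
      (β *L β) -L (β *L β)              ≡⟨ LS.solve 1 (λ b → b :- b := con 0ℤ) refl (β *L β) ⟩
      0L                                ∎
      where
      open ≡-Reasoning
      open LS

    conj-β : conj β ≡ -L β
    conj-β = [ ⊥-elim ∘ conj-β≢β ∘ x∙y⁻¹≈ε⇒x≈y (conj β) β , inverseˡ-unique (conj β) β ]′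
               (L-no-zero-divisors (conj β -L β) (conj β +L β) difference-of-squares)

    conj-pair : ∀ a b → conj (a , b) ≡ (a , - b)
    conj-pair a b = trans (conj-decompose a b) (trans (cong (λ u → ι a +L (u *L ι b)) conj-β)
      (cong₂ _,_ (solve 3 (λ a b al → a :+ (:- con 0ℤ :* b :+ al :* (:- con 1ℤ :* con 0ℤ)) := a) refl a b α)
                 (solve 2 (λ a b → con 0ℤ :+ (:- con 0ℤ :* con 0ℤ :+ :- con 1ℤ :* b) := :- b) refl a b)))
      where open KS

    z*conj-z : ∀ z → z *L conj z ≡ ι (norm z)
    z*conj-z (x , y) = trans (cong ((x , y) *L_) (conj-pair x y))
      (cong₂ _,_ (solve 3 (λ a x y → x :* x :+ a :* (y :* :- y) := x :* x :+ :- (a :* (y :* y))) refl α x y)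
                 (solve 2 (λ x y → x :* :- y :+ y :* x := con 0ℤ) refl x y))
      where open KS

    private
      module NormFibres = FibreCounting norm _≟_

      length-normFibre≤ : ∀ y → length (NormFibres.fibre elementsL y) ℕ.≤ suc q
      length-normFibre≤ y = subst (length (NormFibres.fibre elementsL y) ℕ.≤_) (cong suc (sym q≡2+m))
        (trinomial-roots-bound L-no-zero-divisors 1L≢0L (suc m) 0L (-L ι y) _
          (Unique.filter⁺ (λ z → norm z ≟ y) elementsL-unique)
          (All.tabulate (λ {z} z∈fibre → root z (proj₂ (∈-filter⁻ (λ z → norm z ≟ y) {xs = elementsL} z∈fibre)))))
        where
        root : ∀ z → norm z ≡ y → ((z ^ (2 ℕ.+ suc m)) +L (0L *L z)) +L (-L ι y) ≡ 0L
        root z norm≡y = begin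
          ((z ^ (2 ℕ.+ suc m)) +L (0L *L z)) +L (-L ι y) ≡⟨ cong (λ w → (w +L (0L *L z)) +L (-L ι y)) z^[q+1]≡ι[norm] ⟩
          (ι (norm z) +L (0L *L z)) +L (-L ι y)          ≡⟨ cong (λ n → (ι n +L (0L *L z)) +L (-L ι y)) norm≡y ⟩
          (ι y +L (0L *L z)) +L (-L ι y)                 ≡⟨ solve 2 (λ w z → (w :+ con 0ℤ :* z) :- w := con 0ℤ) refl (ι y) z ⟩
          0L                                             ∎
          where
          open ≡-Reasoning
          open IntegerCoefficientSolver L-commutativeRing
          z^[q+1]≡ι[norm] : z ^ (2 ℕ.+ suc m) ≡ ι (norm z)
          z^[q+1]≡ι[norm] = trans (cong (z *L_) (trans (sym (^L≗^ z (2 ℕ.+ m))) (cong (z ^L_) (sym q≡2+m)))) (z*conj-z z)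

    norm-surjective : ∀ d → Σ L (λ z → norm z ≡ d)
    norm-surjective d = satisfied (decidable-stable (any? (λ z → norm z ≟ d) elementsL) d-is-hit)
      where
      d-is-hit : ¬ ¬ Any (λ z → norm z ≡ d) elementsL
      d-is-hit miss = ℕ.<⇒≱ too-few-values enough-values
        where
        values : List Carrier
        values = filter (λ y → ¬? (y ≟ d)) elements
        norm∈values : ∀ {z} → z ∈ elementsL → norm z ∈ values
        norm∈values z∈ = ∈-filter⁺ (λ y → ¬? (y ≟ d)) (∈-elements _) (λ norm≡d → miss (lose z∈ norm≡d))
        length-values<q : length values ℕ.< q
        length-values<q = subst (length values ℕ.<_) length-elements
          (List.filter-notAll (λ y → ¬? (y ≟ d)) elements (Any.map (λ d≡y y≢d → y≢d (sym d≡y)) (∈-elements d)))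
        enough-values : q ℕ.* q ℕ.≤ length values ℕ.* suc q
        enough-values = subst (ℕ._≤ length values ℕ.* suc q) length-elementsL
          (NormFibres.length≤length*fibreBound values elementsL (suc q) norm∈values length-normFibre≤)
        too-few-values : length values ℕ.* suc q ℕ.< q ℕ.* q
        too-few-values = n<q⇒n*[1+q]<q*q length-values<q

module HermitianPencil {q : ℕ} (K : FiniteField q) (α : FiniteField.Carrier K) where

  open ≡ using (refl; sym; trans; cong; cong₂; module ≡-Reasoning)
  open import Data.Product using (_×_)

  open Over K α
  open QuadraticExtension K α
  private module K = FiniteField K
  open CommutativeRing L-commutativeRing using (_+_; _*_; -_; _-_; +-comm; *-comm; *-assoc; *-identityˡ; *-identityʳ; zeroʳ)

  module _ (α-nonsquare : IsNonsquare α) {p k : ℕ} (p-prime : Prime p) (q≡pᵏ : q ≡ p ℕ.^ suc k)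
           (two≢0 : K.1# K.+ K.1# ≢ K.0#) where

    open Field α-nonsquare
    open Conjugation α-nonsquare {p} {k} p-prime q≡pᵏ
    private
      module KS = IntegerCoefficientSolver (FiniteFieldProperties.commutativeRing K)
      module LS = IntegerCoefficientSolver L-commutativeRing

    conj-neg : ∀ u → conj (- u) ≡ - conj u
    conj-neg (a , b) = trans (conj-pair _ _) (sym (cong -_ (conj-pair a b)))

    conj-involutive : ∀ u → conj (conj u) ≡ u
    conj-involutive (a , b) = trans (cong conj (conj-pair a b)) (trans (conj-pair a (K.- b))
      (cong (a ,_) (KS.solve 1 (λ b → :- :- b := b) refl b)))
      where open KS using (_:=_; :-_)

    inv2 inv2β : L
    inv2  = invL two
    inv2β = invL (two * β)

    two≢0L : two ≢ 0L
    two≢0L = two≢0 ∘ cong proj₁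

    two*inv2 : two * inv2 ≡ 1L
    two*inv2 = invL-inverse two two≢0L

    β*inv2β : β * inv2β ≡ inv2
    β*inv2β = begin
      β * inv2β                    ≡⟨ *-identityˡ _ ⟨
      1L * (β * inv2β)             ≡⟨ cong (_* (β * inv2β)) (trans (*-comm inv2 two) two*inv2) ⟨
      (inv2 * two) * (β * inv2β)   ≡⟨ LS.solve 4 (λ h t b h′ → (h :* t) :* (b :* h′) := h :* ((t :* b) :* h′)) refl inv2 two β inv2β ⟩
      inv2 * ((two * β) * inv2β)   ≡⟨ cong (inv2 *_) (invL-inverse (two * β) two*β≢0) ⟩
      inv2 * 1L                    ≡⟨ *-identityʳ inv2 ⟩
      inv2                         ∎
      where
      open ≡-Reasoning
      open LS using (_:=_; _:*_)
      two*β≢0 : two * β ≢ 0L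
      two*β≢0 = [ two≢0L , (λ β≡0 → FiniteFieldProperties.1≢0 K (cong proj₂ β≡0)) ]′ ∘ L-no-zero-divisors two β

    conj-inv2 : conj inv2 ≡ inv2
    conj-inv2 = trans (conj-pair _ _) (cong (proj₁ inv2 ,_)
      (KS.solve 1 (λ i → :- (:- (con 0ℤ :+ con 0ℤ) :* i) := :- (con 0ℤ :+ con 0ℤ) :* i) refl (norm two K.⁻¹)))
      where open KS using (_:=_; _:+_; _:*_; :-_; con)

    conj-inv2β : conj inv2β ≡ - inv2β
    conj-inv2β = trans (conj-pair _ _) (cong (_, proj₂ (- inv2β))
      (KS.solve 2 (λ a i → x′ a :* i := :- (x′ a :* i)) refl α (norm (two * β) K.⁻¹)))
      where
      open KS using (_:=_; _:+_; _:*_; :-_; con)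
      x′ = λ a → (con 1ℤ :+ con 1ℤ) :* con 0ℤ :+ a :* ((con 0ℤ :+ con 0ℤ) :* con 1ℤ)

    infix 4 _≐_
    _≐_ : Mat → Mat → Set
    M ≐ N = ∀ i j → M i j ≡ N i j

    Hermitian : Mat → Set
    Hermitian M = M ⋆ ≐ M

    H₁-hermitian : ∀ A → Hermitian (H₁ A)
    H₁-hermitian A i j = begin
      conj (inv2 * (A j i + conj (A i j)))                ≡⟨ conj-* inv2 _ ⟩
      conj inv2 * conj (A j i + conj (A i j))             ≡⟨ cong₂ _*_ conj-inv2 (conj-+ (A j i) _) ⟩
      inv2 * (conj (A j i) + conj (conj (A i j)))         ≡⟨ cong (λ u → inv2 * (conj (A j i) + u)) (conj-involutive (A i j)) ⟩
      inv2 * (conj (A j i) + A i j)                       ≡⟨ cong (inv2 *_) (+-comm _ _) ⟩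
      inv2 * (A i j + conj (A j i))                       ∎
      where open ≡-Reasoning

    H₂-hermitian : ∀ A → Hermitian (H₂ A)
    H₂-hermitian A i j = begin
      conj (inv2β * (A j i - conj (A i j)))               ≡⟨ conj-* inv2β _ ⟩
      conj inv2β * conj (A j i - conj (A i j))            ≡⟨ cong₂ _*_ conj-inv2β (conj-+ (A j i) _) ⟩
      - inv2β * (conj (A j i) + conj (- conj (A i j)))    ≡⟨ cong (λ u → - inv2β * (conj (A j i) + u)) (trans (conj-neg _) (cong -_ (conj-involutive (A i j)))) ⟩
      - inv2β * (conj (A j i) - A i j)                    ≡⟨ LS.solve 3 (λ h a b → :- h :* (b :- a) := h :* (a :- b)) refl inv2β (A i j) (conj (A j i)) ⟩
      inv2β * (A i j - conj (A j i))                      ∎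
      where
      open ≡-Reasoning
      open LS using (_:=_; _:-_; _:*_; :-_)

    δ-hermitian : Hermitian δ
    δ-hermitian 0F 0F = conj-ι K.1#
    δ-hermitian 0F 1F = conj-ι K.0#
    δ-hermitian 1F 0F = conj-ι K.0#
    δ-hermitian 1F 1F = conj-ι K.1#

    H₁+βH₂ : ∀ A i j → H₁ A i j + β * H₂ A i j ≡ A i j
    H₁+βH₂ A i j = begin
      inv2 * (a + b) + β * (inv2β * (a - b))   ≡⟨ cong (inv2 * (a + b) +_) (trans (sym (*-assoc β inv2β _)) (cong (_* (a - b)) β*inv2β)) ⟩
      inv2 * (a + b) + inv2 * (a - b)          ≡⟨ LS.solve 3 (λ h a b → h :* (a :+ b) :+ h :* (a :- b) := ((con 1ℤ :+ con 1ℤ) :* h) :* a) refl inv2 a b ⟩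
      (two * inv2) * a                         ≡⟨ cong (_* a) two*inv2 ⟩
      1L * a                                   ≡⟨ *-identityˡ a ⟩
      a                                        ∎
      where
      open ≡-Reasoning
      open LS using (_:=_; _:+_; _:-_; _:*_; con)
      a = A i j
      b = conj (A j i)

    det : Mat → L
    det M = M 0F 0F * M 1F 1F - M 0F 1F * M 1F 0F

    -- det (D + M) = det D + polar D M + det M
    polar : Mat → Mat → L
    polar D M = (D 0F 0F * M 1F 1F + M 0F 0F * D 1F 1F) - (D 0F 1F * M 1F 0F + M 0F 1F * D 1F 0F)

    det-cong : ∀ {M N} → M ≐ N → det M ≡ det N
    det-cong M≐N = cong₂ _-_ (cong₂ _*_ (M≐N 0F 0F) (M≐N 1F 1F)) (cong₂ _*_ (M≐N 0F 1F) (M≐N 1F 0F))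

    polar-cong : ∀ {D D′ M M′} → D ≐ D′ → M ≐ M′ → polar D M ≡ polar D′ M′
    polar-cong D≐ M≐ = cong₂ _-_ (cong₂ _+_ (cong₂ _*_ (D≐ 0F 0F) (M≐ 1F 1F)) (cong₂ _*_ (M≐ 0F 0F) (D≐ 1F 1F)))
                                 (cong₂ _+_ (cong₂ _*_ (D≐ 0F 1F) (M≐ 1F 0F)) (cong₂ _*_ (M≐ 0F 1F) (D≐ 1F 0F)))

    Point : Set
    Point = Fin 3 → L

    coefficient : Mat → Fin 3 → Mat
    coefficient A 0F = H₁ A
    coefficient A 1F = H₂ A
    coefficient A 2F = δ

    pencilAt : Mat → Point → Mat
    pencilAt A X i j = X 0F * H₁ A i j + X 1F * H₂ A i j + X 2F * δ i j

    gradient : Mat → Point → Fin 3 → L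
    gradient A X c = polar (coefficient A c) (pencilAt A X)

    eval-pencil : ∀ A X → (λ i j → eval X (pencil A i j)) ≐ pencilAt A X
    eval-pencil A X 0F 0F = cong₂ _+_ refl (sym (*-identityʳ (X 2F)))
    eval-pencil A X 0F 1F = cong₂ _+_ refl (sym (zeroʳ (X 2F)))
    eval-pencil A X 1F 0F = cong₂ _+_ refl (sym (zeroʳ (X 2F)))
    eval-pencil A X 1F 1F = cong₂ _+_ refl (sym (*-identityʳ (X 2F)))

    private
      along-x : ∀ h k x y → ((1L * h + x * 0L) + (0L * k + y * 0L)) + 0L ≡ h
      along-x = LS.solve 4 (λ h k x y → ((con 1ℤ :* h :+ x :* con 0ℤ) :+ (con 0ℤ :* k :+ y :* con 0ℤ)) :+ con 0ℤ := h) refl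
        where open LS using (_:=_; _:+_; _:*_; con)
      along-y : ∀ h k x y → ((0L * h + x * 0L) + (1L * k + y * 0L)) + 0L ≡ k
      along-y = LS.solve 4 (λ h k x y → ((con 0ℤ :* h :+ x :* con 0ℤ) :+ (con 1ℤ :* k :+ y :* con 0ℤ)) :+ con 0ℤ := k) refl
        where open LS using (_:=_; _:+_; _:*_; con)
      along-t : ∀ h k x y d → ((0L * h + x * 0L) + (0L * k + y * 0L)) + d ≡ d
      along-t = LS.solve 5 (λ h k x y d → ((con 0ℤ :* h :+ x :* con 0ℤ) :+ (con 0ℤ :* k :+ y :* con 0ℤ)) :+ d := d) refl
        where open LS using (_:=_; _:+_; _:*_; con)

    eval-∂-pencil : ∀ A X c → (λ i j → eval X (∂ c (pencil A i j))) ≐ coefficient A c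
    eval-∂-pencil A X 0F 0F 0F = along-x _ _ _ _
    eval-∂-pencil A X 0F 0F 1F = along-x _ _ _ _
    eval-∂-pencil A X 0F 1F 0F = along-x _ _ _ _
    eval-∂-pencil A X 0F 1F 1F = along-x _ _ _ _
    eval-∂-pencil A X 1F 0F 0F = along-y _ _ _ _
    eval-∂-pencil A X 1F 0F 1F = along-y _ _ _ _
    eval-∂-pencil A X 1F 1F 0F = along-y _ _ _ _
    eval-∂-pencil A X 1F 1F 1F = along-y _ _ _ _
    eval-∂-pencil A X 2F 0F 0F = along-t _ _ _ _ _
    eval-∂-pencil A X 2F 0F 1F = along-t _ _ _ _ _
    eval-∂-pencil A X 2F 1F 0F = along-t _ _ _ _ _
    eval-∂-pencil A X 2F 1F 1F = along-t _ _ _ _ _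

    eval-baseF : ∀ A X → eval X (baseF A) ≡ det (pencilAt A X)
    eval-baseF A X = det-cong (eval-pencil A X)

    eval-∂-baseF : ∀ A X c → eval X (∂ c (baseF A)) ≡ gradient A X c
    eval-∂-baseF A X c = polar-cong (eval-∂-pencil A X c) (eval-pencil A X)

    private
      polarₑ : ∀ {n} (d₀₀ d₀₁ d₁₀ d₁₁ m₀₀ m₀₁ m₁₀ m₁₁ : LS.Polynomial n) → LS.Polynomial n
      polarₑ d₀₀ d₀₁ d₁₀ d₁₁ m₀₀ m₀₁ m₁₀ m₁₁ = (d₀₀ :* m₁₁ :+ m₀₀ :* d₁₁) :- (d₀₁ :* m₁₀ :+ m₀₁ :* d₁₀)
        where open LS using (_:+_; _:-_; _:*_)

    polar-scaleʳ : ∀ D s M → polar D (scale s M) ≡ s * polar D M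
    polar-scaleʳ D s M = LS.solve 9
      (λ s d₀₀ d₀₁ d₁₀ d₁₁ m₀₀ m₀₁ m₁₀ m₁₁ →
         polarₑ d₀₀ d₀₁ d₁₀ d₁₁ (s :* m₀₀) (s :* m₀₁) (s :* m₁₀) (s :* m₁₁) := s :* polarₑ d₀₀ d₀₁ d₁₀ d₁₁ m₀₀ m₀₁ m₁₀ m₁₁)
      refl s (D 0F 0F) (D 0F 1F) (D 1F 0F) (D 1F 1F) (M 0F 0F) (M 0F 1F) (M 1F 0F) (M 1F 1F)
      where open LS using (_:=_; _:*_)

    polar-subʳ : ∀ D M N → polar D (M -M N) ≡ polar D M - polar D N
    polar-subʳ D M N = LS.solve 12
      (λ d₀₀ d₀₁ d₁₀ d₁₁ m₀₀ m₀₁ m₁₀ m₁₁ n₀₀ n₀₁ n₁₀ n₁₁ →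
         polarₑ d₀₀ d₀₁ d₁₀ d₁₁ (m₀₀ :- n₀₀) (m₀₁ :- n₀₁) (m₁₀ :- n₁₀) (m₁₁ :- n₁₁)
         := polarₑ d₀₀ d₀₁ d₁₀ d₁₁ m₀₀ m₀₁ m₁₀ m₁₁ :- polarₑ d₀₀ d₀₁ d₁₀ d₁₁ n₀₀ n₀₁ n₁₀ n₁₁)
      refl (D 0F 0F) (D 0F 1F) (D 1F 0F) (D 1F 1F) (M 0F 0F) (M 0F 1F) (M 1F 0F) (M 1F 1F) (N 0F 0F) (N 0F 1F) (N 1F 0F) (N 1F 1F)
      where open LS using (_:=_; _:-_)

    polar-+ˡ : ∀ D E M → polar (D +M E) M ≡ polar D M + polar E M
    polar-+ˡ D E M = LS.solve 12
      (λ d₀₀ d₀₁ d₁₀ d₁₁ e₀₀ e₀₁ e₁₀ e₁₁ m₀₀ m₀₁ m₁₀ m₁₁ →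
         polarₑ (d₀₀ :+ e₀₀) (d₀₁ :+ e₀₁) (d₁₀ :+ e₁₀) (d₁₁ :+ e₁₁) m₀₀ m₀₁ m₁₀ m₁₁
         := polarₑ d₀₀ d₀₁ d₁₀ d₁₁ m₀₀ m₀₁ m₁₀ m₁₁ :+ polarₑ e₀₀ e₀₁ e₁₀ e₁₁ m₀₀ m₀₁ m₁₀ m₁₁)
      refl (D 0F 0F) (D 0F 1F) (D 1F 0F) (D 1F 1F) (E 0F 0F) (E 0F 1F) (E 1F 0F) (E 1F 1F) (M 0F 0F) (M 0F 1F) (M 1F 0F) (M 1F 1F)
      where open LS using (_:=_; _:+_)

    polar-scaleˡ : ∀ s D M → polar (scale s D) M ≡ s * polar D M
    polar-scaleˡ s D M = LS.solve 9
      (λ s d₀₀ d₀₁ d₁₀ d₁₁ m₀₀ m₀₁ m₁₀ m₁₁ →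
         polarₑ (s :* d₀₀) (s :* d₀₁) (s :* d₁₀) (s :* d₁₁) m₀₀ m₀₁ m₁₀ m₁₁ := s :* polarₑ d₀₀ d₀₁ d₁₀ d₁₁ m₀₀ m₀₁ m₁₀ m₁₁)
      refl s (D 0F 0F) (D 0F 1F) (D 1F 0F) (D 1F 1F) (M 0F 0F) (M 0F 1F) (M 1F 0F) (M 1F 1F)
      where open LS using (_:=_; _:*_)

    polar-self : ∀ M → polar M M ≡ two * det M
    polar-self M = LS.solve 4
      (λ m₀₀ m₀₁ m₁₀ m₁₁ → polarₑ m₀₀ m₀₁ m₁₀ m₁₁ m₀₀ m₀₁ m₁₀ m₁₁ := (con 1ℤ :+ con 1ℤ) :* (m₀₀ :* m₁₁ :- m₀₁ :* m₁₀))
      refl (M 0F 0F) (M 0F 1F) (M 1F 0F) (M 1F 1F)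
      where open LS using (_:=_; _:+_; _:-_; _:*_; con)

    det-scale : ∀ s M → det (scale s M) ≡ (s * s) * det M
    det-scale s M = LS.solve 5
      (λ s m₀₀ m₀₁ m₁₀ m₁₁ → (s :* m₀₀) :* (s :* m₁₁) :- (s :* m₀₁) :* (s :* m₁₀) := (s :* s) :* (m₀₀ :* m₁₁ :- m₀₁ :* m₁₀))
      refl s (M 0F 0F) (M 0F 1F) (M 1F 0F) (M 1F 1F)
      where open LS using (_:=_; _:-_; _:*_)

    conj-- : ∀ u v → conj (u - v) ≡ conj u - conj v
    conj-- u v = trans (conj-+ u (- v)) (cong (conj u +_) (conj-neg v))

    conj-*+* : ∀ a b c d → conj (a * b + c * d) ≡ conj a * conj b + conj c * conj d
    conj-*+* a b c d = trans (conj-+ (a * b) (c * d)) (cong₂ _+_ (conj-* a b) (conj-* c d))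

    conj-polar : ∀ D M → conj (polar D M) ≡ polar (D ⋆) (M ⋆)
    conj-polar D M = begin
      conj (polar D M)                                       ≡⟨ conj-- _ _ ⟩
      conj (D 0F 0F * M 1F 1F + M 0F 0F * D 1F 1F)
        - conj (D 0F 1F * M 1F 0F + M 0F 1F * D 1F 0F)       ≡⟨ cong₂ _-_ (conj-*+* _ _ _ _) (conj-*+* _ _ _ _) ⟩
      (conj (D 0F 0F) * conj (M 1F 1F) + conj (M 0F 0F) * conj (D 1F 1F))
        - (conj (D 0F 1F) * conj (M 1F 0F) + conj (M 0F 1F) * conj (D 1F 0F))
                                                             ≡⟨ cong₂ _-_ refl (LS.solve 4 (λ a b c d → a :* b :+ c :* d := d :* c :+ b :* a) refl _ _ _ _) ⟩
      polar (D ⋆) (M ⋆)                                      ∎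
      where
      open ≡-Reasoning
      open LS using (_:=_; _:+_; _:*_)

    coefficient-hermitian : ∀ A c → Hermitian (coefficient A c)
    coefficient-hermitian A 0F = H₁-hermitian A
    coefficient-hermitian A 1F = H₂-hermitian A
    coefficient-hermitian A 2F = δ-hermitian

    pencilAt-conj : ∀ A X → pencilAt A (conj ∘ X) ≐ pencilAt A X ⋆
    pencilAt-conj A X i j = sym (begin
      conj (X 0F * H₁ A j i + X 1F * H₂ A j i + X 2F * δ j i)                          ≡⟨ conj-+ _ _ ⟩
      conj (X 0F * H₁ A j i + X 1F * H₂ A j i) + conj (X 2F * δ j i)                  ≡⟨ cong₂ _+_ (conj-*+* _ _ _ _) (conj-* _ _) ⟩
      conj (X 0F) * conj (H₁ A j i) + conj (X 1F) * conj (H₂ A j i) + conj (X 2F) * conj (δ j i)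
        ≡⟨ cong₂ _+_ (cong₂ _+_ (cong (_ *_) (H₁-hermitian A i j)) (cong (_ *_) (H₂-hermitian A i j))) (cong (_ *_) (δ-hermitian i j)) ⟩
      conj (X 0F) * H₁ A i j + conj (X 1F) * H₂ A i j + conj (X 2F) * δ i j            ∎)
      where open ≡-Reasoning

    pencilAt-scale : ∀ A s X → pencilAt A (λ c → s * X c) ≐ scale s (pencilAt A X)
    pencilAt-scale A s X i j = LS.solve 7
      (λ s x y t h k d → s :* x :* h :+ s :* y :* k :+ s :* t :* d := s :* (x :* h :+ y :* k :+ t :* d))
      refl s (X 0F) (X 1F) (X 2F) (H₁ A i j) (H₂ A i j) (δ i j)
      where open LS using (_:=_; _:+_; _:*_)

    pencilAt-sub : ∀ A X Y → pencilAt A (λ c → X c - Y c) ≐ pencilAt A X -M pencilAt A Y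
    pencilAt-sub A X Y i j = LS.solve 9
      (λ x y t x′ y′ t′ h k d → (x :- x′) :* h :+ (y :- y′) :* k :+ (t :- t′) :* d
                                := (x :* h :+ y :* k :+ t :* d) :- (x′ :* h :+ y′ :* k :+ t′ :* d))
      refl (X 0F) (X 1F) (X 2F) (Y 0F) (Y 1F) (Y 2F) (H₁ A i j) (H₂ A i j) (δ i j)
      where open LS using (_:=_; _:+_; _:-_; _:*_)

    gradient-scale : ∀ A s X c → gradient A (λ c′ → s * X c′) c ≡ s * gradient A X c
    gradient-scale A s X c = trans (polar-cong {D′ = coefficient A c} (λ _ _ → refl) (pencilAt-scale A s X)) (polar-scaleʳ (coefficient A c) s (pencilAt A X))

    gradient-sub : ∀ A X Y c → gradient A (λ c′ → X c′ - Y c′) c ≡ gradient A X c - gradient A Y c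
    gradient-sub A X Y c = trans (polar-cong {D′ = coefficient A c} (λ _ _ → refl) (pencilAt-sub A X Y)) (polar-subʳ (coefficient A c) (pencilAt A X) (pencilAt A Y))

    gradient-conj : ∀ A X c → gradient A (conj ∘ X) c ≡ conj (gradient A X c)
    gradient-conj A X c = trans (polar-cong {D′ = coefficient A c ⋆} (λ i j → sym (coefficient-hermitian A c i j)) (pencilAt-conj A X))
                                (sym (conj-polar (coefficient A c) (pencilAt A X)))

    euler : ∀ A X → X 0F * gradient A X 0F + X 1F * gradient A X 1F + X 2F * gradient A X 2F ≡ two * det (pencilAt A X)
    euler A X = begin
      X 0F * polar (H₁ A) M + X 1F * polar (H₂ A) M + X 2F * polar δ M
        ≡⟨ cong₂ _+_ (cong₂ _+_ (polar-scaleˡ (X 0F) (H₁ A) M) (polar-scaleˡ (X 1F) (H₂ A) M)) (polar-scaleˡ (X 2F) δ M) ⟨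
      polar (scale (X 0F) (H₁ A)) M + polar (scale (X 1F) (H₂ A)) M + polar (scale (X 2F) δ) M
        ≡⟨ cong (_+ polar (scale (X 2F) δ) M) (polar-+ˡ (scale (X 0F) (H₁ A)) (scale (X 1F) (H₂ A)) M) ⟨
      polar (scale (X 0F) (H₁ A) +M scale (X 1F) (H₂ A)) M + polar (scale (X 2F) δ) M
        ≡⟨ polar-+ˡ (scale (X 0F) (H₁ A) +M scale (X 1F) (H₂ A)) (scale (X 2F) δ) M ⟨
      polar M M
        ≡⟨ polar-self M ⟩
      two * det M ∎
      where
      open ≡-Reasoning
      M = pencilAt A X

    target : K.Carrier → K.Carrier → Fin 3 → L
    target a b 0F = ι a
    target a b 1F = ι b
    target a b 2F = 1L

    normalised-dual-point : ∀ A a b → InDual (baseF A) a b →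
      Σ Point (λ X → det (pencilAt A X) ≡ 0L × (∀ c → gradient A X c ≡ target a b c))
    normalised-dual-point A a b (P , _ , F[P]≡0 , _ , λ′ , λ′≢0 , ∂₀ , ∂₁ , ∂₂) = X , det≡0 , gradient≡target
      where
      open ≡-Reasoning
      μ = invL λ′
      X : Point
      X c = μ * P c
      μλ′≡1 : μ * λ′ ≡ 1L
      μλ′≡1 = trans (*-comm μ λ′) (invL-inverse λ′ λ′≢0)
      det≡0 : det (pencilAt A X) ≡ 0L
      det≡0 = begin
        det (pencilAt A X)               ≡⟨ det-cong (pencilAt-scale A μ P) ⟩
        det (scale μ (pencilAt A P))     ≡⟨ det-scale μ (pencilAt A P) ⟩
        (μ * μ) * det (pencilAt A P)     ≡⟨ cong ((μ * μ) *_) (trans (sym (eval-baseF A P)) F[P]≡0) ⟩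
        (μ * μ) * 0L                     ≡⟨ zeroʳ (μ * μ) ⟩
        0L                               ∎
      ∂≡λ′*target : ∀ c → eval P (∂ c (baseF A)) ≡ λ′ * target a b c
      ∂≡λ′*target 0F = ∂₀
      ∂≡λ′*target 1F = ∂₁
      ∂≡λ′*target 2F = ∂₂
      gradient≡target : ∀ c → gradient A X c ≡ target a b c
      gradient≡target c = begin
        gradient A X c                   ≡⟨ gradient-scale A μ P c ⟩
        μ * gradient A P c               ≡⟨ cong (μ *_) (trans (sym (eval-∂-baseF A P c)) (∂≡λ′*target c)) ⟩
        μ * (λ′ * target a b c)          ≡⟨ *-assoc μ λ′ _ ⟨
        (μ * λ′) * target a b c          ≡⟨ cong (_* target a b c) μλ′≡1 ⟩
        1L * target a b c                ≡⟨ *-identityˡ _ ⟩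
        target a b c                     ∎

    pencilAt-cong : ∀ A {X Y} → (∀ c → X c ≡ Y c) → pencilAt A X ≐ pencilAt A Y
    pencilAt-cong A X≗Y i j = cong₂ _+_ (cong₂ _+_ (cong (_* H₁ A i j) (X≗Y 0F)) (cong (_* H₂ A i j) (X≗Y 1F))) (cong (_* δ i j) (X≗Y 2F))

    hermitian-at-real-gradient : ∀ A (X : Point) (t : Fin 3 → L) → NonsingularCurve (baseF A) →
      (∀ c → gradient A X c ≡ t c) → (∀ c → conj (t c) ≡ t c) → Hermitian (pencilAt A X)
    hermitian-at-real-gradient A X t nonsingular gradient≡t t-real i j = begin
      conj (pencilAt A X j i)       ≡⟨ pencilAt-conj A X i j ⟨
      pencilAt A (conj ∘ X) i j     ≡⟨ pencilAt-cong A (λ c → sym (x∙y⁻¹≈ε⇒x≈y (X c) (conj (X c)) (D≡0 c))) i j ⟩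
      pencilAt A X i j              ∎
      where
      open ≡-Reasoning
      D : Point
      D c = X c - conj (X c)
      gradient-D : ∀ c → gradient A D c ≡ 0L
      gradient-D c = begin
        gradient A D c                              ≡⟨ gradient-sub A X (conj ∘ X) c ⟩
        gradient A X c - gradient A (conj ∘ X) c    ≡⟨ cong₂ _-_ refl (gradient-conj A X c) ⟩
        gradient A X c - conj (gradient A X c)      ≡⟨ cong₂ _-_ (gradient≡t c) (cong conj (gradient≡t c)) ⟩
        t c - conj (t c)                            ≡⟨ cong₂ _-_ refl (t-real c) ⟩
        t c - t c                                   ≡⟨ LS.solve 1 (λ x → x :- x := con 0ℤ) refl (t c) ⟩
        0L                                          ∎
        where open LS using (_:=_; _:-_; con)
      det-D : det (pencilAt A D) ≡ 0L
      det-D = [ ⊥-elim ∘ two≢0L , (λ det≡0 → det≡0) ]′ (L-no-zero-divisors two _ (begin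
        two * det (pencilAt A D)                                      ≡⟨ euler A D ⟨
        D 0F * gradient A D 0F + D 1F * gradient A D 1F + D 2F * gradient A D 2F
                                                                      ≡⟨ cong₂ _+_ (cong₂ _+_ (cong (D 0F *_) (gradient-D 0F)) (cong (D 1F *_) (gradient-D 1F))) (cong (D 2F *_) (gradient-D 2F)) ⟩
        D 0F * 0L + D 1F * 0L + D 2F * 0L                             ≡⟨ LS.solve 3 (λ x y z → x :* con 0ℤ :+ y :* con 0ℤ :+ z :* con 0ℤ := con 0ℤ) refl (D 0F) (D 1F) (D 2F) ⟩
        0L                                                            ∎))
        where open LS using (_:=_; _:+_; _:*_; con)
      D≡0 : ∀ c → D c ≡ 0L
      D≡0 = decidable-stable (Fin.all? (λ c → D c ≟L 0L))
              (λ D≢0 → nonsingular D D≢0 (trans (eval-baseF A D) det-D , λ c → trans (eval-∂-baseF A D c) (gradient-D c)))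

    conj-fixed⇒ι : ∀ z → conj z ≡ z → z ≡ ι (proj₁ z)
    conj-fixed⇒ι (a , b) conj-z≡z = cong (a ,_) ([ ⊥-elim ∘ two≢0 , (λ b≡0 → b≡0) ]′ (FiniteFieldProperties.no-zero-divisors K _ b (begin
      (K.1# K.+ K.1#) K.* b      ≡⟨ KS.solve 1 (λ b → (con 1ℤ :+ con 1ℤ) :* b := b :+ b) refl b ⟩
      b K.+ b                    ≡⟨ cong (b K.+_) (cong proj₂ (trans (sym (conj-pair a b)) conj-z≡z)) ⟨
      b K.+ K.- b                ≡⟨ KS.solve 1 (λ b → b :+ :- b := con 0ℤ) refl b ⟩
      K.0#                       ∎)))
      where
      open ≡-Reasoning
      open KS using (_:=_; _:+_; _:*_; :-_; con)

    real⇒norm : ∀ z → conj z ≡ z → Σ L (λ s → s * conj s ≡ z)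
    real⇒norm z conj-z≡z = s , trans (z*conj-z s) (trans (cong ι norm-s≡z₁) (sym (conj-fixed⇒ι z conj-z≡z)))
      where
      s = proj₁ (norm-surjective (proj₁ z))
      norm-s≡z₁ = proj₂ (norm-surjective (proj₁ z))

    z*conj-z≡0⇒z≡0 : ∀ z → z * conj z ≡ 0L → z ≡ 0L
    z*conj-z≡0⇒z≡0 z z*conj-z≡0 = decidable-stable (z ≟L 0L) (λ z≢0 → norm-≢0 z z≢0 (cong proj₁ (trans (sym (z*conj-z z)) z*conj-z≡0)))

    *-cancelˡ : ∀ a {x y} → a ≢ 0L → a * x ≡ a * y → x ≡ y
    *-cancelˡ a {x} {y} a≢0 ax≡ay = begin
      x                     ≡⟨ *-identityˡ x ⟨
      1L * x                ≡⟨ cong (_* x) (trans (*-comm (invL a) a) (invL-inverse a a≢0)) ⟨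
      (invL a * a) * x      ≡⟨ trans (*-assoc _ a x) (trans (cong (invL a *_) ax≡ay) (sym (*-assoc _ a y))) ⟩
      (invL a * a) * y      ≡⟨ cong (_* y) (trans (*-comm (invL a) a) (invL-inverse a a≢0)) ⟩
      1L * y                ≡⟨ *-identityˡ y ⟩
      y                     ∎
      where open ≡-Reasoning

    outer : Vec2 → Mat
    outer v i j = v i * conj (v j)

    det≡0⇒N₀₁N₁₀≡N₀₀N₁₁ : ∀ N → det N ≡ 0L → N 0F 1F * N 1F 0F ≡ N 0F 0F * N 1F 1F
    det≡0⇒N₀₁N₁₀≡N₀₀N₁₁ N det≡0 = begin
      N 0F 1F * N 1F 0F                 ≡⟨ LS.solve 4 (λ a b c d → b :* c := a :* d :- (a :* d :- b :* c)) refl (N 0F 0F) (N 0F 1F) (N 1F 0F) (N 1F 1F) ⟩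
      N 0F 0F * N 1F 1F - det N         ≡⟨ cong₂ _-_ refl det≡0 ⟩
      N 0F 0F * N 1F 1F - 0L            ≡⟨ LS.solve 1 (λ x → x :- con 0ℤ := x) refl _ ⟩
      N 0F 0F * N 1F 1F                 ∎
      where
      open ≡-Reasoning
      open LS using (_:=_; _:-_; _:*_; con)

    private
      rank-one-at-zero-corner : ∀ N → Hermitian N → det N ≡ 0L → N 0F 0F ≡ 0L → Σ Vec2 (λ v → N ≐ outer v)
      rank-one-at-zero-corner N hermitian det≡0 N₀₀≡0 = v , N≐vv*
        where
        s = proj₁ (real⇒norm (N 1F 1F) (hermitian 1F 1F))
        v : Vec2
        v 0F = 0L
        v 1F = s
        N₀₁≡0 : N 0F 1F ≡ 0L
        N₀₁≡0 = z*conj-z≡0⇒z≡0 (N 0F 1F) (begin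
          N 0F 1F * conj (N 0F 1F)     ≡⟨ cong (N 0F 1F *_) (hermitian 1F 0F) ⟩
          N 0F 1F * N 1F 0F            ≡⟨ det≡0⇒N₀₁N₁₀≡N₀₀N₁₁ N det≡0 ⟩
          N 0F 0F * N 1F 1F            ≡⟨ cong (_* N 1F 1F) N₀₀≡0 ⟩
          0L * N 1F 1F                 ≡⟨ trans (*-comm _ _) (zeroʳ _) ⟩
          0L                           ∎)
          where open ≡-Reasoning
        N≐vv* : N ≐ outer v
        N≐vv* 0F 0F = trans N₀₀≡0 (sym (trans (*-comm _ _) (zeroʳ _)))
        N≐vv* 0F 1F = trans N₀₁≡0 (sym (trans (*-comm _ _) (zeroʳ _)))
        N≐vv* 1F 0F = trans (sym (hermitian 1F 0F)) (trans (cong conj N₀₁≡0) (trans (conj-ι K.0#) (sym (trans (cong (s *_) (conj-ι K.0#)) (zeroʳ s)))))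
        N≐vv* 1F 1F = sym (proj₂ (real⇒norm (N 1F 1F) (hermitian 1F 1F)))

      rank-one-at-nonzero-corner : ∀ N → Hermitian N → det N ≡ 0L → N 0F 0F ≢ 0L → Σ Vec2 (λ v → N ≐ outer v)
      rank-one-at-nonzero-corner N hermitian det≡0 N₀₀≢0 = v , N≐vv*
        where
        open ≡-Reasoning
        s = proj₁ (real⇒norm (N 0F 0F) (hermitian 0F 0F))
        s*s̄≡N₀₀ : s * conj s ≡ N 0F 0F
        s*s̄≡N₀₀ = proj₂ (real⇒norm (N 0F 0F) (hermitian 0F 0F))
        s̄≢0 : conj s ≢ 0L
        s̄≢0 s̄≡0 = N₀₀≢0 (trans (sym s*s̄≡N₀₀) (trans (cong (s *_) s̄≡0) (zeroʳ s)))
        v : Vec2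
        v 0F = s
        v 1F = N 1F 0F * invL (conj s)
        N₁₀≡v₁s̄ : N 1F 0F ≡ v 1F * conj s
        N₁₀≡v₁s̄ = sym (trans (*-assoc _ _ _) (trans (cong (N 1F 0F *_) (trans (*-comm _ _) (invL-inverse (conj s) s̄≢0))) (*-identityʳ _)))
        N₀₁≡sv̄₁ : N 0F 1F ≡ s * conj (v 1F)
        N₀₁≡sv̄₁ = begin
          N 0F 1F                          ≡⟨ hermitian 0F 1F ⟨
          conj (N 1F 0F)                   ≡⟨ cong conj N₁₀≡v₁s̄ ⟩
          conj (v 1F * conj s)             ≡⟨ conj-* _ _ ⟩
          conj (v 1F) * conj (conj s)      ≡⟨ cong (conj (v 1F) *_) (conj-involutive s) ⟩
          conj (v 1F) * s                  ≡⟨ *-comm _ s ⟩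
          s * conj (v 1F)                  ∎
        N₁₁≡v₁v̄₁ : N 1F 1F ≡ v 1F * conj (v 1F)
        N₁₁≡v₁v̄₁ = *-cancelˡ (N 0F 0F) N₀₀≢0 (begin
          N 0F 0F * N 1F 1F                        ≡⟨ det≡0⇒N₀₁N₁₀≡N₀₀N₁₁ N det≡0 ⟨
          N 0F 1F * N 1F 0F                        ≡⟨ cong₂ _*_ N₀₁≡sv̄₁ N₁₀≡v₁s̄ ⟩
          (s * conj (v 1F)) * (v 1F * conj s)      ≡⟨ LS.solve 4 (λ s s̄ w w̄ → (s :* w̄) :* (w :* s̄) := (s :* s̄) :* (w :* w̄)) refl s (conj s) (v 1F) (conj (v 1F)) ⟩
          (s * conj s) * (v 1F * conj (v 1F))      ≡⟨ cong (_* (v 1F * conj (v 1F))) s*s̄≡N₀₀ ⟩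
          N 0F 0F * (v 1F * conj (v 1F))           ∎)
          where open LS using (_:=_; _:*_)
        N≐vv* : N ≐ outer v
        N≐vv* 0F 0F = sym s*s̄≡N₀₀
        N≐vv* 0F 1F = N₀₁≡sv̄₁
        N≐vv* 1F 0F = N₁₀≡v₁s̄
        N≐vv* 1F 1F = N₁₁≡v₁v̄₁

    hermitian-rank-one : ∀ N → Hermitian N → det N ≡ 0L → Σ Vec2 (λ v → N ≐ outer v)
    hermitian-rank-one N hermitian det≡0 with N 0F 0F ≟L 0L
    ... | yes N₀₀≡0 = rank-one-at-zero-corner N hermitian det≡0 N₀₀≡0
    ... | no  N₀₀≢0 = rank-one-at-nonzero-corner N hermitian det≡0 N₀₀≢0

    adj : Mat → Mat
    adj M 0F 0F = M 1F 1F
    adj M 0F 1F = - M 0F 1F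
    adj M 1F 0F = - M 1F 0F
    adj M 1F 1F = M 0F 0F

    traceProduct : Mat → Mat → L
    traceProduct D N = (D 0F 0F * N 0F 0F + D 0F 1F * N 1F 0F) + (D 1F 0F * N 0F 1F + D 1F 1F * N 1F 1F)

    polar≡traceProduct-adj : ∀ D M → polar D M ≡ traceProduct D (adj M)
    polar≡traceProduct-adj D M = LS.solve 8
      (λ d₀₀ d₀₁ d₁₀ d₁₁ m₀₀ m₀₁ m₁₀ m₁₁ →
         polarₑ d₀₀ d₀₁ d₁₀ d₁₁ m₀₀ m₀₁ m₁₀ m₁₁ := (d₀₀ :* m₁₁ :+ d₀₁ :* :- m₁₀) :+ (d₁₀ :* :- m₀₁ :+ d₁₁ :* m₀₀))
      refl (D 0F 0F) (D 0F 1F) (D 1F 0F) (D 1F 1F) (M 0F 0F) (M 0F 1F) (M 1F 0F) (M 1F 1F)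
      where open LS using (_:=_; _:+_; _:*_; :-_)

    adj-hermitian : ∀ M → Hermitian M → Hermitian (adj M)
    adj-hermitian M hermitian 0F 0F = hermitian 1F 1F
    adj-hermitian M hermitian 0F 1F = trans (conj-neg _) (cong -_ (hermitian 0F 1F))
    adj-hermitian M hermitian 1F 0F = trans (conj-neg _) (cong -_ (hermitian 1F 0F))
    adj-hermitian M hermitian 1F 1F = hermitian 0F 0F

    det-adj : ∀ M → det (adj M) ≡ det M
    det-adj M = LS.solve 4 (λ a b c d → d :* a :- :- b :* :- c := a :* d :- b :* c) refl (M 0F 0F) (M 0F 1F) (M 1F 0F) (M 1F 1F)
      where open LS using (_:=_; _:-_; _:*_; :-_)

    ⟨Av,v⟩≡traceProduct : ∀ A v → ⟨ mulVec A v , v ⟩ ≡ traceProduct A (outer v)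
    ⟨Av,v⟩≡traceProduct A v = LS.solve 8
      (λ a₀₀ a₀₁ a₁₀ a₁₁ v₀ v₁ v̄₀ v̄₁ →
         v̄₀ :* (a₀₀ :* v₀ :+ a₀₁ :* v₁) :+ v̄₁ :* (a₁₀ :* v₀ :+ a₁₁ :* v₁)
         := (a₀₀ :* (v₀ :* v̄₀) :+ a₀₁ :* (v₁ :* v̄₀)) :+ (a₁₀ :* (v₀ :* v̄₁) :+ a₁₁ :* (v₁ :* v̄₁)))
      refl (A 0F 0F) (A 0F 1F) (A 1F 0F) (A 1F 1F) (v 0F) (v 1F) (conj (v 0F)) (conj (v 1F))
      where open LS using (_:=_; _:+_; _:*_)

    ⟨v,v⟩≡trace : ∀ v → ⟨ v , v ⟩ ≡ outer v 0F 0F + outer v 1F 1F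
    ⟨v,v⟩≡trace v = cong₂ _+_ (*-comm _ _) (*-comm _ _)

    traceProduct-cong : ∀ D {N N′} → N ≐ N′ → traceProduct D N ≡ traceProduct D N′
    traceProduct-cong D N≐N′ = cong₂ _+_ (cong₂ _+_ (cong (D 0F 0F *_) (N≐N′ 0F 0F)) (cong (D 0F 1F *_) (N≐N′ 1F 0F)))
                                    (cong₂ _+_ (cong (D 1F 0F *_) (N≐N′ 0F 1F)) (cong (D 1F 1F *_) (N≐N′ 1F 1F)))

    traceProduct-H₁+βH₂ : ∀ A N → traceProduct A N ≡ traceProduct (H₁ A) N + β * traceProduct (H₂ A) N
    traceProduct-H₁+βH₂ A N = trans (cong₂ _+_ (cong₂ _+_ (cong (_* N 0F 0F) (sym (H₁+βH₂ A 0F 0F))) (cong (_* N 1F 0F) (sym (H₁+βH₂ A 0F 1F))))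
                                          (cong₂ _+_ (cong (_* N 0F 1F) (sym (H₁+βH₂ A 1F 0F))) (cong (_* N 1F 1F) (sym (H₁+βH₂ A 1F 1F)))))
      (LS.solve 13 (λ b h₀₀ h₀₁ h₁₀ h₁₁ k₀₀ k₀₁ k₁₀ k₁₁ n₀₀ n₀₁ n₁₀ n₁₁ →
         ((h₀₀ :+ b :* k₀₀) :* n₀₀ :+ (h₀₁ :+ b :* k₀₁) :* n₁₀) :+ ((h₁₀ :+ b :* k₁₀) :* n₀₁ :+ (h₁₁ :+ b :* k₁₁) :* n₁₁)
         := ((h₀₀ :* n₀₀ :+ h₀₁ :* n₁₀) :+ (h₁₀ :* n₀₁ :+ h₁₁ :* n₁₁)) :+ b :* ((k₀₀ :* n₀₀ :+ k₀₁ :* n₁₀) :+ (k₁₀ :* n₀₁ :+ k₁₁ :* n₁₁)))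
       refl β (H₁ A 0F 0F) (H₁ A 0F 1F) (H₁ A 1F 0F) (H₁ A 1F 1F) (H₂ A 0F 0F) (H₂ A 0F 1F) (H₂ A 1F 0F) (H₂ A 1F 1F)
            (N 0F 0F) (N 0F 1F) (N 1F 0F) (N 1F 1F))
      where open LS using (_:=_; _:+_; _:*_)

    polar-δ : ∀ M → polar δ M ≡ M 1F 1F + M 0F 0F
    polar-δ M = LS.solve 4 (λ m₀₀ m₀₁ m₁₀ m₁₁ → polarₑ (con 1ℤ) (con 0ℤ) (con 0ℤ) (con 1ℤ) m₀₀ m₀₁ m₁₀ m₁₁ := m₁₁ :+ m₀₀)
      refl (M 0F 0F) (M 0F 1F) (M 1F 0F) (M 1F 1F)
      where open LS using (_:=_; _:+_; con)

    target-real : ∀ a b c → conj (target a b c) ≡ target a b c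
    target-real a b 0F = conj-ι a
    target-real a b 1F = conj-ι b
    target-real a b 2F = conj-ι K.1#

    dual-point-in-numerical-range : ∀ A a b → NonsingularCurve (baseF A) → InDual (baseF A) a b → InW A (a , b)
    dual-point-in-numerical-range A a b nonsingular dual = v , ⟨v,v⟩≡1 , ⟨Av,v⟩≡a+βb
      where
      open ≡-Reasoning
      normalised = normalised-dual-point A a b dual
      X = proj₁ normalised
      det≡0 = proj₁ (proj₂ normalised)
      gradient≡target = proj₂ (proj₂ normalised)
      M = pencilAt A X
      M-hermitian = hermitian-at-real-gradient A X (target a b) nonsingular gradient≡target (target-real a b)
      N = adj M
      factorisation = hermitian-rank-one N (adj-hermitian M M-hermitian) (trans (det-adj M) det≡0)
      v = proj₁ factorisation
      N≐vv* = proj₂ factorisation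
      ⟨v,v⟩≡1 : ⟨ v , v ⟩ ≡ 1L
      ⟨v,v⟩≡1 = begin
        ⟨ v , v ⟩                      ≡⟨ ⟨v,v⟩≡trace v ⟩
        outer v 0F 0F + outer v 1F 1F  ≡⟨ cong₂ _+_ (N≐vv* 0F 0F) (N≐vv* 1F 1F) ⟨
        M 1F 1F + M 0F 0F              ≡⟨ polar-δ M ⟨
        gradient A X 2F                ≡⟨ gradient≡target 2F ⟩
        1L                             ∎
      ⟨Av,v⟩≡a+βb : ⟨ mulVec A v , v ⟩ ≡ (a , b)
      ⟨Av,v⟩≡a+βb = begin
        ⟨ mulVec A v , v ⟩                                ≡⟨ ⟨Av,v⟩≡traceProduct A v ⟩
        traceProduct A (outer v)                               ≡⟨ traceProduct-cong A N≐vv* ⟨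
        traceProduct A N                                       ≡⟨ traceProduct-H₁+βH₂ A N ⟩
        traceProduct (H₁ A) N + β * traceProduct (H₂ A) N           ≡⟨ cong₂ (λ x y → x + β * y) (polar≡traceProduct-adj (H₁ A) M) (polar≡traceProduct-adj (H₂ A) M) ⟨
        gradient A X 0F + β * gradient A X 1F             ≡⟨ cong₂ (λ x y → x + β * y) (gradient≡target 0F) (gradient≡target 1F) ⟩
        ι a + β * ι b                                     ≡⟨ decompose a b ⟨
        (a , b)                                           ∎


open import Data.Nat using (_^_)
open import Data.Product using (_×_)

proposition1p3 :
    (q : ℕ) →
    (Σ ℕ λ p → Σ ℕ λ k → Prime p × 1 ≤ k × q ≡ p ^ k) →
    ¬ (2 ∣ q) →
    (K : FiniteField q) →
    (α : FiniteField.Carrier K) →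
    Over.IsNonsquare K α α →
    (A : Over.Mat K α) →
    Over.NonsingularCurve K α (Over.baseF K α A) →
    (a b : FiniteField.Carrier K) →
    Over.InDual K α (Over.baseF K α A) a b →
    Over.InW K α A (a , b)
proposition1p3 q (p , zero  , _       , ()  , _  ) _     K α _           A _           a b _
proposition1p3 q (p , suc k , p-prime , _   , q≡pᵏ) q-odd K α α-nonsquare A nonsingular a b dual =
  HermitianPencil.dual-point-in-numerical-range K α α-nonsquare {p} {k} p-prime q≡pᵏ (FiniteFieldProperties.1+1≢0 K q-odd)
    A a b nonsingular dual
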